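{- Let $q$ be a power of a prime $p$, $A=\mathbb{F}_q[t]$, $n$ a positive integer, and $G$ a finite subgroup of $\mathrm{GL}_n(A)$. Then the largest divisor of $\#G$ prime to $p$ divides $\prod_{s=1}^{n}(q^s-1)$. -}

module Defs where

open import Level using (Level; _⊔_)
open import Data.Nat as ℕ using (ℕ; zero; suc; _∸_; _^_)
open import Data.Nat.Divisibility using (_∣_)
open import Data.Nat.Primality using (Prime)
open import Data.Nat.Coprimality using (Coprime)
open import Data.Fin using (Fin; zero; suc; _≟_)
open import Data.List using (List; []; _∷_; length; map)
open import Data.List.Relation.Unary.All using (All)
open import Data.List.Relation.Unary.Any using (Any)
open import Data.List.Relation.Unary.AllPairs using (AllPairs)
open import Data.Product using (Σ; ∃; _×_; _,_)
open import Data.Unit.Polymorphic using (⊤)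
open import Relation.Nullary using (¬_; yes; no)
open import Relation.Binary.PropositionalEquality using (_≡_)
open import Algebra.Bundles using (CommutativeRing)
open import Function.Bundles using (Inverse)
open import Relation.Binary.Bundles using (Setoid)
import Relation.Binary.PropositionalEquality as P

-- Fields (agda-stdlib has no Field bundle): a commutative ring with
-- 0 ≉ 1 in which every nonzero element has a multiplicative inverse.

record IsField {c ℓ : Level} (R : CommutativeRing c ℓ) : Set (c ⊔ ℓ) where
  open CommutativeRing R hiding (zero)
  field
    0≉1     : ¬ (0# ≈ 1#)
    inverse : ∀ x → ¬ (x ≈ 0#) → Σ Carrier (λ y → x * y ≈ 1#)

HasCard : {c ℓ : Level} → CommutativeRing c ℓ → ℕ → Set (c ⊔ ℓ)
HasCard R q = Inverse (CommutativeRing.setoid R) (P.setoid (Fin q))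

module PolyMat {c ℓ : Level} (R : CommutativeRing c ℓ) where
  open CommutativeRing R renaming (Carrier to K) hiding (zero)

  -- polynomials as coefficient lists, lowest degree first
  Poly : Set c
  Poly = List K

  -- equality of polynomials (trailing zeros ignored)
  infix 4 _≈ₚ_
  _≈ₚ_ : Poly → Poly → Set ℓ
  []       ≈ₚ []       = ⊤
  []       ≈ₚ (b ∷ bs) = (b ≈ 0#) × ([] ≈ₚ bs)
  (a ∷ as) ≈ₚ []       = (a ≈ 0#) × (as ≈ₚ [])
  (a ∷ as) ≈ₚ (b ∷ bs) = (a ≈ b) × (as ≈ₚ bs)

  0ₚ : Poly
  0ₚ = []

  1ₚ : Poly
  1ₚ = 1# ∷ []

  infixl 6 _+ₚ_
  _+ₚ_ : Poly → Poly → Poly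
  []       +ₚ bs       = bs
  (a ∷ as) +ₚ []       = a ∷ as
  (a ∷ as) +ₚ (b ∷ bs) = (a + b) ∷ (as +ₚ bs)

  infixl 7 _*ₚ_
  _*ₚ_ : Poly → Poly → Poly
  []       *ₚ bs = []
  (a ∷ as) *ₚ bs = map (a *_) bs +ₚ (0# ∷ (as *ₚ bs))

  Mat : ℕ → Set c
  Mat n = Fin n → Fin n → Poly

  infix 4 _≈ₘ_
  _≈ₘ_ : ∀ {n} → Mat n → Mat n → Set ℓ
  M ≈ₘ N = ∀ i j → M i j ≈ₚ N i j

  ∑ : ∀ {n} → (Fin n → Poly) → Poly
  ∑ {zero}  f = 0ₚ
  ∑ {suc n} f = f zero +ₚ ∑ (λ k → f (suc k))

  infixl 7 _·_
  _·_ : ∀ {n} → Mat n → Mat n → Mat n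
  (M · N) i j = ∑ (λ k → M i k *ₚ N k j)

  I : ∀ {n} → Mat n
  I i j with i ≟ j
  ... | yes _ = 1ₚ
  ... | no  _ = 0ₚ

  InGL : ∀ {n} → Mat n → Set (c ⊔ ℓ)
  InGL M = Σ (Mat _) (λ N → (M · N ≈ₘ I) × (N · M ≈ₘ I))

  infix 4 _∈ₘ_
  _∈ₘ_ : ∀ {n} → Mat n → List (Mat n) → Set (c ⊔ ℓ)
  M ∈ₘ G = Any (λ N → M ≈ₘ N) G

  -- A finite subgroup of GL_n(A), given by the list of its elements
  -- without repetition (so #G = length elems).
  record FiniteSubgroupGL (n : ℕ) : Set (c ⊔ ℓ) where
    field
      elems    : List (Mat n)
      distinct : AllPairs (λ M N → ¬ (M ≈ₘ N)) elems
      inGL     : All InGL elems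
      hasId    : I ∈ₘ elems
      mulClosed : ∀ {M N} → M ∈ₘ elems → N ∈ₘ elems → (M · N) ∈ₘ elems
      invClosed : ∀ {M} → M ∈ₘ elems →
                  Σ (Mat n) (λ N → (N ∈ₘ elems) × (M · N ≈ₘ I) × (N · M ≈ₘ I))

  order : ∀ {n} → FiniteSubgroupGL n → ℕ
  order G = length (FiniteSubgroupGL.elems G)

IsLargestDivisorPrimeTo : ℕ → ℕ → ℕ → Set
IsLargestDivisorPrimeTo p N m =
  (m ∣ N) × Coprime m p × (∀ d → d ∣ N → Coprime d p → d ℕ.≤ m)

prodGL : ℕ → ℕ → ℕ
prodGL q zero    = 1
prodGL q (suc n) = prodGL q n ℕ.* (q ^ suc n ∸ 1)

{-# OPTIONS --safe #-}
module Submission where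

-- Let d bound the degrees of the entries of the elements of G. Left multiplication lets G act on
-- the n × n matrices over A/(t^(d+1)) whose constant term is invertible, and the action is free:
-- two elements of G that agree modulo t^(d+1) after multiplying such a matrix agree modulo t^(d+1)
-- (cancel the constant term and induct), hence are equal by the degree bound. So #G divides the
-- number of these matrices, #GL_n(F_q) · q^(n²d), and #GL_n(F_q) = ∏_{k<n} (q^n - q^k) is a power
-- of q times ∏_{s=1}^{n} (q^s - 1). A divisor of #G prime to p is prime to q, so it divides the product.

open import Defs
open import Level using (Level; _⊔_)
open import Data.Nat as ℕ using (ℕ; zero; suc; _^_; _∸_; _≥_)
import Data.Nat.Properties as ℕ
import Data.Nat.Solver
open import Data.Nat.Divisibility using (_∣_; ∣-trans)
open import Data.Nat.Coprimality using (Coprime; coprime-divisor)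
open import Data.Nat.Primality using (Prime)
open import Data.Fin as Fin using (Fin; zero; suc; _≟_)
import Data.Fin.Properties as Fin
open import Data.Bool using (Bool; true; false; _∧_; not)
open import Data.Empty using (⊥-elim)
open import Data.Unit.Polymorphic using (tt)
open import Data.Product using (Σ; ∃; _,_; proj₁; proj₂)
open import Data.List using ([]; _∷_; map; length; lookup)
open import Data.List.Relation.Unary.All as All using ()
open import Data.List.Relation.Unary.Any as Any using ()
open import Data.List.Relation.Unary.Any.Properties using (lookup-index)
open import Data.List.Relation.Unary.AllPairs using (AllPairs; _∷_)
open import Data.List.Membership.Setoid.Properties using (∈-lookup)
open import Data.List.Membership.Propositional.Properties using () renaming (∈-lookup to ∈ₚ-lookup)
open import Data.Vec.Functional using (Vector) renaming (_∷_ to _∷ᵛ_)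
open import Relation.Nullary using (¬_; Dec; yes; no; does)
open import Relation.Nullary.Decidable using (map′; _×-dec_; _→-dec_; ¬?; does-⇔; dec-true; via-injection)
open import Relation.Binary.Bundles using (Setoid)
open import Relation.Binary.PropositionalEquality as ≡ using (_≡_; _≢_)
open import Function using (_∘_; case_of_)
open import Function.Bundles using (Inverse; Injection; mk⇔)
open import Function.Properties.Inverse using (Inverse⇒Injection)
open import Algebra.Bundles using (CommutativeMonoid; CommutativeRing; Semiring)
open import Algebra.Structures using (IsSemiring)

module _ {a ℓ : Level} (M : CommutativeMonoid a ℓ) where
  open CommutativeMonoid M
  open import Algebra.Properties.CommutativeMonoid.Sum M

  sum-δ : ∀ {n} (f : Vector Carrier n) (i : Fin n) → (∀ k → k ≢ i → f k ≈ ε) → sum f ≈ f i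
  sum-δ {suc n} f zero    f≈ε =
    trans (∙-congˡ (trans (sum-cong-≋ {n} λ k → f≈ε (suc k) λ ()) (sum-replicate-zero n))) (identityʳ (f zero))
  sum-δ {suc n} f (suc i) f≈ε =
    trans (∙-cong (f≈ε zero λ ()) (sum-δ (f ∘ suc) i λ k k≢i → f≈ε (suc k) (k≢i ∘ Fin.suc-injective)))
          (identityˡ (f (suc i)))

module Polynomials {c ℓ : Level} (R : CommutativeRing c ℓ) where
  open CommutativeRing R renaming (Carrier to K) hiding (zero)
  open PolyMat R
  open import Relation.Binary.Reasoning.Setoid setoid
  open import Algebra.Properties.CommutativeSemigroup +-commutativeSemigroup using (interchange)

  coeff : ℕ → Poly → K
  coeff _       []       = 0#
  coeff zero    (a ∷ _)  = a
  coeff (suc k) (_ ∷ as) = coeff k as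

  tl : Poly → Poly
  tl []       = []
  tl (_ ∷ as) = as

  scale : K → Poly → Poly
  scale a = map (a *_)

  infix 4 _≋_
  record _≋_ (x y : Poly) : Set ℓ where
    constructor mk≋
    field ≋-coeff : ∀ k → coeff k x ≈ coeff k y
  open _≋_ public

  ≈ₚ⇒coeff-≈ : ∀ x y → x ≈ₚ y → ∀ k → coeff k x ≈ coeff k y
  ≈ₚ⇒coeff-≈ []       []       _         k       = refl
  ≈ₚ⇒coeff-≈ []       (b ∷ bs) (b≈0 , _) zero    = sym b≈0
  ≈ₚ⇒coeff-≈ []       (b ∷ bs) (_ , e)   (suc k) = ≈ₚ⇒coeff-≈ [] bs e k
  ≈ₚ⇒coeff-≈ (a ∷ as) []       (a≈0 , _) zero    = a≈0
  ≈ₚ⇒coeff-≈ (a ∷ as) []       (_ , e)   (suc k) = ≈ₚ⇒coeff-≈ as [] e k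
  ≈ₚ⇒coeff-≈ (a ∷ as) (b ∷ bs) (a≈b , _) zero    = a≈b
  ≈ₚ⇒coeff-≈ (a ∷ as) (b ∷ bs) (_ , e)   (suc k) = ≈ₚ⇒coeff-≈ as bs e k

  coeff-≈⇒≈ₚ : ∀ x y → (∀ k → coeff k x ≈ coeff k y) → x ≈ₚ y
  coeff-≈⇒≈ₚ []       []       e = tt
  coeff-≈⇒≈ₚ []       (b ∷ bs) e = sym (e zero) , coeff-≈⇒≈ₚ [] bs (e ∘ suc)
  coeff-≈⇒≈ₚ (a ∷ as) []       e = e zero , coeff-≈⇒≈ₚ as [] (e ∘ suc)
  coeff-≈⇒≈ₚ (a ∷ as) (b ∷ bs) e = e zero , coeff-≈⇒≈ₚ as bs (e ∘ suc)

  ≈ₚ⇒≋ : ∀ {x y} → x ≈ₚ y → x ≋ y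
  ≈ₚ⇒≋ {x} {y} e = mk≋ (≈ₚ⇒coeff-≈ x y e)

  ≋⇒≈ₚ : ∀ {x y} → x ≋ y → x ≈ₚ y
  ≋⇒≈ₚ {x} {y} e = coeff-≈⇒≈ₚ x y (≋-coeff e)

  ≋-refl : ∀ {x} → x ≋ x
  ≋-refl = mk≋ λ _ → refl

  ≋-sym : ∀ {x y} → x ≋ y → y ≋ x
  ≋-sym e = mk≋ λ k → sym (≋-coeff e k)

  ≋-trans : ∀ {x y z} → x ≋ y → y ≋ z → x ≋ z
  ≋-trans e f = mk≋ λ k → trans (≋-coeff e k) (≋-coeff f k)

  coeff-tl : ∀ k x → coeff k (tl x) ≈ coeff (suc k) x
  coeff-tl k []      = refl
  coeff-tl k (_ ∷ _) = refl

  coeff-+ₚ : ∀ k x y → coeff k (x +ₚ y) ≈ coeff k x + coeff k y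
  coeff-+ₚ k       []      y       = sym (+-identityˡ _)
  coeff-+ₚ k       (a ∷ x) []      = sym (+-identityʳ _)
  coeff-+ₚ zero    (a ∷ x) (b ∷ y) = refl
  coeff-+ₚ (suc k) (a ∷ x) (b ∷ y) = coeff-+ₚ k x y

  coeff-scale : ∀ k a y → coeff k (scale a y) ≈ a * coeff k y
  coeff-scale k       a []      = sym (zeroʳ a)
  coeff-scale zero    a (b ∷ y) = refl
  coeff-scale (suc k) a (b ∷ y) = coeff-scale k a y

  coeff₀-*ₚ : ∀ x y → coeff 0 (x *ₚ y) ≈ coeff 0 x * coeff 0 y
  coeff₀-*ₚ []      y = sym (zeroˡ _)
  coeff₀-*ₚ (a ∷ x) y = trans (coeff-+ₚ 0 (scale a y) (0# ∷ (x *ₚ y)))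
                              (trans (+-identityʳ _) (coeff-scale 0 a y))

  coeffₛ-*ₚ : ∀ k x y → coeff (suc k) (x *ₚ y) ≈ coeff 0 x * coeff (suc k) y + coeff k (tl x *ₚ y)
  coeffₛ-*ₚ k []      y = sym (trans (+-identityʳ _) (zeroˡ _))
  coeffₛ-*ₚ k (a ∷ x) y = trans (coeff-+ₚ (suc k) (scale a y) (0# ∷ (x *ₚ y)))
                                (+-congʳ (coeff-scale (suc k) a y))

  coeff₀-cong : ∀ {x y} → x ≋ y → coeff 0 x ≈ coeff 0 y
  coeff₀-cong e = ≋-coeff e 0

  tl-cong : ∀ {x y} → x ≋ y → tl x ≋ tl y
  tl-cong {x} {y} e = mk≋ λ k → trans (coeff-tl k x) (trans (≋-coeff e (suc k)) (sym (coeff-tl k y)))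

  tl-+ₚ : ∀ x y → tl (x +ₚ y) ≋ tl x +ₚ tl y
  tl-+ₚ x y = mk≋ λ k → begin
    coeff k (tl (x +ₚ y))             ≈⟨ coeff-tl k (x +ₚ y) ⟩
    coeff (suc k) (x +ₚ y)            ≈⟨ coeff-+ₚ (suc k) x y ⟩
    coeff (suc k) x + coeff (suc k) y ≈⟨ +-cong (coeff-tl k x) (coeff-tl k y) ⟨
    coeff k (tl x) + coeff k (tl y)   ≈⟨ coeff-+ₚ k (tl x) (tl y) ⟨
    coeff k (tl x +ₚ tl y)            ∎

  tl-scale : ∀ a y → tl (scale a y) ≋ scale a (tl y)
  tl-scale a y = mk≋ λ k → begin
    coeff k (tl (scale a y))  ≈⟨ coeff-tl k (scale a y) ⟩
    coeff (suc k) (scale a y) ≈⟨ coeff-scale (suc k) a y ⟩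
    a * coeff (suc k) y       ≈⟨ *-congˡ (coeff-tl k y) ⟨
    a * coeff k (tl y)        ≈⟨ coeff-scale k a (tl y) ⟨
    coeff k (scale a (tl y))  ∎

  tl-*ₚ : ∀ x y → tl (x *ₚ y) ≋ scale (coeff 0 x) (tl y) +ₚ tl x *ₚ y
  tl-*ₚ x y = mk≋ λ k → begin
    coeff k (tl (x *ₚ y))                              ≈⟨ coeff-tl k (x *ₚ y) ⟩
    coeff (suc k) (x *ₚ y)                             ≈⟨ coeffₛ-*ₚ k x y ⟩
    coeff 0 x * coeff (suc k) y + coeff k (tl x *ₚ y)  ≈⟨ +-congʳ (*-congˡ (coeff-tl k y)) ⟨
    coeff 0 x * coeff k (tl y) + coeff k (tl x *ₚ y)   ≈⟨ +-congʳ (coeff-scale k (coeff 0 x) (tl y)) ⟨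
    coeff k (scale (coeff 0 x) (tl y)) + coeff k (tl x *ₚ y) ≈⟨ coeff-+ₚ k (scale (coeff 0 x) (tl y)) (tl x *ₚ y) ⟨
    coeff k (scale (coeff 0 x) (tl y) +ₚ tl x *ₚ y)    ∎

  infix 4 _≈[_]_
  _≈[_]_ : Poly → ℕ → Poly → Set ℓ
  x ≈[ J ] y = ∀ k → k ℕ.< J → coeff k x ≈ coeff k y

  coeff-≥length : ∀ k x → length x ℕ.≤ k → coeff k x ≈ 0#
  coeff-≥length k       []      _              = refl
  coeff-≥length (suc k) (a ∷ x) (ℕ.s≤s |x|≤k) = coeff-≥length k x |x|≤k

  ≈[]⇒≋ : ∀ {J x y} → length x ℕ.≤ J → length y ℕ.≤ J → x ≈[ J ] y → x ≋ y
  ≈[]⇒≋ {J} {x} {y} |x|≤J |y|≤J x≈y = mk≋ λ k → case k ℕ.<? J of λ where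
    (yes k<J) → x≈y k k<J
    (no  k≮J) → let J≤k = ℕ.≮⇒≥ k≮J in
                trans (coeff-≥length k x (ℕ.≤-trans |x|≤J J≤k)) (sym (coeff-≥length k y (ℕ.≤-trans |y|≤J J≤k)))

  fromCoeffs : ∀ {m} → Vector K m → Poly
  fromCoeffs {zero}  f = []
  fromCoeffs {suc m} f = f zero ∷ fromCoeffs (f ∘ suc)

  coeff-fromCoeffs : ∀ {m} (k : Fin m) (f : Vector K m) → coeff (Fin.toℕ k) (fromCoeffs f) ≈ f k
  coeff-fromCoeffs zero    f = refl
  coeff-fromCoeffs (suc k) f = coeff-fromCoeffs k (f ∘ suc)

  coeff-fromCoeffs-< : ∀ {m} k (k<m : k ℕ.< m) (f : Vector K m) → coeff k (fromCoeffs f) ≈ f (Fin.fromℕ< k<m)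
  coeff-fromCoeffs-< {suc m} zero    _           f = refl
  coeff-fromCoeffs-< {suc m} (suc k) (ℕ.s≤s k<m) f = coeff-fromCoeffs-< k k<m (f ∘ suc)

  fromCoeffs-cong : ∀ {m} {f g : Vector K m} → (∀ k → f k ≈ g k) → fromCoeffs f ≋ fromCoeffs g
  fromCoeffs-cong {zero}  e = ≋-refl
  fromCoeffs-cong {suc m} e = mk≋ λ { zero → e zero ; (suc k) → ≋-coeff (fromCoeffs-cong (e ∘ suc)) k }

  +ₚ-cong : ∀ {x x′ y y′} → x ≋ x′ → y ≋ y′ → x +ₚ y ≋ x′ +ₚ y′
  +ₚ-cong {x} {x′} {y} {y′} e f = mk≋ λ k →
    trans (coeff-+ₚ k x y) (trans (+-cong (≋-coeff e k) (≋-coeff f k)) (sym (coeff-+ₚ k x′ y′)))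

  +ₚ-assoc : ∀ x y z → (x +ₚ y) +ₚ z ≋ x +ₚ (y +ₚ z)
  +ₚ-assoc x y z = mk≋ λ k → begin
    coeff k ((x +ₚ y) +ₚ z)             ≈⟨ coeff-+ₚ k (x +ₚ y) z ⟩
    coeff k (x +ₚ y) + coeff k z        ≈⟨ +-congʳ (coeff-+ₚ k x y) ⟩
    (coeff k x + coeff k y) + coeff k z ≈⟨ +-assoc _ _ _ ⟩
    coeff k x + (coeff k y + coeff k z) ≈⟨ +-congˡ (coeff-+ₚ k y z) ⟨
    coeff k x + coeff k (y +ₚ z)        ≈⟨ coeff-+ₚ k x (y +ₚ z) ⟨
    coeff k (x +ₚ (y +ₚ z))             ∎

  +ₚ-comm : ∀ x y → x +ₚ y ≋ y +ₚ x
  +ₚ-comm x y = mk≋ λ k → trans (coeff-+ₚ k x y) (trans (+-comm _ _) (sym (coeff-+ₚ k y x)))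

  +ₚ-identityʳ : ∀ x → x +ₚ [] ≋ x
  +ₚ-identityʳ x = mk≋ λ k → trans (coeff-+ₚ k x []) (+-identityʳ _)

  *ₚ-cong-coeff : ∀ k {x x′ y y′} → x ≋ x′ → y ≋ y′ → coeff k (x *ₚ y) ≈ coeff k (x′ *ₚ y′)
  *ₚ-cong-coeff zero    {x} {x′} {y} {y′} e f =
    trans (coeff₀-*ₚ x y) (trans (*-cong (coeff₀-cong e) (≋-coeff f 0)) (sym (coeff₀-*ₚ x′ y′)))
  *ₚ-cong-coeff (suc k) {x} {x′} {y} {y′} e f =
    trans (coeffₛ-*ₚ k x y)
      (trans (+-cong (*-cong (coeff₀-cong e) (≋-coeff f (suc k))) (*ₚ-cong-coeff k (tl-cong e) f))
             (sym (coeffₛ-*ₚ k x′ y′)))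

  *ₚ-cong : ∀ {x x′ y y′} → x ≋ x′ → y ≋ y′ → x *ₚ y ≋ x′ *ₚ y′
  *ₚ-cong e f = mk≋ λ k → *ₚ-cong-coeff k e f

  *ₚ-distribˡ-coeff : ∀ k x y z → coeff k (x *ₚ (y +ₚ z)) ≈ coeff k (x *ₚ y +ₚ x *ₚ z)
  *ₚ-distribˡ-coeff zero x y z = begin
    coeff 0 (x *ₚ (y +ₚ z))                     ≈⟨ coeff₀-*ₚ x (y +ₚ z) ⟩
    coeff 0 x * coeff 0 (y +ₚ z)                ≈⟨ *-congˡ (coeff-+ₚ 0 y z) ⟩
    coeff 0 x * (coeff 0 y + coeff 0 z)         ≈⟨ distribˡ _ _ _ ⟩
    coeff 0 x * coeff 0 y + coeff 0 x * coeff 0 z ≈⟨ +-cong (coeff₀-*ₚ x y) (coeff₀-*ₚ x z) ⟨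
    coeff 0 (x *ₚ y) + coeff 0 (x *ₚ z)         ≈⟨ coeff-+ₚ 0 (x *ₚ y) (x *ₚ z) ⟨
    coeff 0 (x *ₚ y +ₚ x *ₚ z)                  ∎
  *ₚ-distribˡ-coeff (suc k) x y z = begin
    coeff (suc k) (x *ₚ (y +ₚ z))
      ≈⟨ coeffₛ-*ₚ k x (y +ₚ z) ⟩
    coeff 0 x * coeff (suc k) (y +ₚ z) + coeff k (tl x *ₚ (y +ₚ z))
      ≈⟨ +-cong (*-congˡ (coeff-+ₚ (suc k) y z))
                (trans (*ₚ-distribˡ-coeff k (tl x) y z) (coeff-+ₚ k (tl x *ₚ y) (tl x *ₚ z))) ⟩
    coeff 0 x * (coeff (suc k) y + coeff (suc k) z) + (coeff k (tl x *ₚ y) + coeff k (tl x *ₚ z))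
      ≈⟨ +-congʳ (distribˡ _ _ _) ⟩
    (coeff 0 x * coeff (suc k) y + coeff 0 x * coeff (suc k) z) + (coeff k (tl x *ₚ y) + coeff k (tl x *ₚ z))
      ≈⟨ interchange _ _ _ _ ⟩
    (coeff 0 x * coeff (suc k) y + coeff k (tl x *ₚ y)) + (coeff 0 x * coeff (suc k) z + coeff k (tl x *ₚ z))
      ≈⟨ +-cong (coeffₛ-*ₚ k x y) (coeffₛ-*ₚ k x z) ⟨
    coeff (suc k) (x *ₚ y) + coeff (suc k) (x *ₚ z)
      ≈⟨ coeff-+ₚ (suc k) (x *ₚ y) (x *ₚ z) ⟨
    coeff (suc k) (x *ₚ y +ₚ x *ₚ z) ∎

  *ₚ-distribʳ-coeff : ∀ k x y z → coeff k ((y +ₚ z) *ₚ x) ≈ coeff k (y *ₚ x +ₚ z *ₚ x)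
  *ₚ-distribʳ-coeff zero x y z = begin
    coeff 0 ((y +ₚ z) *ₚ x)                     ≈⟨ coeff₀-*ₚ (y +ₚ z) x ⟩
    coeff 0 (y +ₚ z) * coeff 0 x                ≈⟨ *-congʳ (coeff-+ₚ 0 y z) ⟩
    (coeff 0 y + coeff 0 z) * coeff 0 x         ≈⟨ distribʳ _ _ _ ⟩
    coeff 0 y * coeff 0 x + coeff 0 z * coeff 0 x ≈⟨ +-cong (coeff₀-*ₚ y x) (coeff₀-*ₚ z x) ⟨
    coeff 0 (y *ₚ x) + coeff 0 (z *ₚ x)         ≈⟨ coeff-+ₚ 0 (y *ₚ x) (z *ₚ x) ⟨
    coeff 0 (y *ₚ x +ₚ z *ₚ x)                  ∎
  *ₚ-distribʳ-coeff (suc k) x y z = begin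
    coeff (suc k) ((y +ₚ z) *ₚ x)
      ≈⟨ coeffₛ-*ₚ k (y +ₚ z) x ⟩
    coeff 0 (y +ₚ z) * coeff (suc k) x + coeff k (tl (y +ₚ z) *ₚ x)
      ≈⟨ +-cong (*-congʳ (coeff-+ₚ 0 y z))
                (trans (*ₚ-cong-coeff k (tl-+ₚ y z) ≋-refl)
                  (trans (*ₚ-distribʳ-coeff k x (tl y) (tl z)) (coeff-+ₚ k (tl y *ₚ x) (tl z *ₚ x)))) ⟩
    (coeff 0 y + coeff 0 z) * coeff (suc k) x + (coeff k (tl y *ₚ x) + coeff k (tl z *ₚ x))
      ≈⟨ +-congʳ (distribʳ _ _ _) ⟩
    (coeff 0 y * coeff (suc k) x + coeff 0 z * coeff (suc k) x) + (coeff k (tl y *ₚ x) + coeff k (tl z *ₚ x))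
      ≈⟨ interchange _ _ _ _ ⟩
    (coeff 0 y * coeff (suc k) x + coeff k (tl y *ₚ x)) + (coeff 0 z * coeff (suc k) x + coeff k (tl z *ₚ x))
      ≈⟨ +-cong (coeffₛ-*ₚ k y x) (coeffₛ-*ₚ k z x) ⟨
    coeff (suc k) (y *ₚ x) + coeff (suc k) (z *ₚ x)
      ≈⟨ coeff-+ₚ (suc k) (y *ₚ x) (z *ₚ x) ⟨
    coeff (suc k) (y *ₚ x +ₚ z *ₚ x) ∎

  scale-*ₚ-coeff : ∀ k a y z → coeff k (scale a y *ₚ z) ≈ a * coeff k (y *ₚ z)
  scale-*ₚ-coeff zero a y z = begin
    coeff 0 (scale a y *ₚ z)        ≈⟨ coeff₀-*ₚ (scale a y) z ⟩
    coeff 0 (scale a y) * coeff 0 z ≈⟨ *-congʳ (coeff-scale 0 a y) ⟩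
    (a * coeff 0 y) * coeff 0 z     ≈⟨ *-assoc _ _ _ ⟩
    a * (coeff 0 y * coeff 0 z)     ≈⟨ *-congˡ (coeff₀-*ₚ y z) ⟨
    a * coeff 0 (y *ₚ z)            ∎
  scale-*ₚ-coeff (suc k) a y z = begin
    coeff (suc k) (scale a y *ₚ z)
      ≈⟨ coeffₛ-*ₚ k (scale a y) z ⟩
    coeff 0 (scale a y) * coeff (suc k) z + coeff k (tl (scale a y) *ₚ z)
      ≈⟨ +-cong (*-congʳ (coeff-scale 0 a y))
                (trans (*ₚ-cong-coeff k (tl-scale a y) ≋-refl) (scale-*ₚ-coeff k a (tl y) z)) ⟩
    (a * coeff 0 y) * coeff (suc k) z + a * coeff k (tl y *ₚ z)
      ≈⟨ +-congʳ (*-assoc _ _ _) ⟩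
    a * (coeff 0 y * coeff (suc k) z) + a * coeff k (tl y *ₚ z)
      ≈⟨ distribˡ _ _ _ ⟨
    a * (coeff 0 y * coeff (suc k) z + coeff k (tl y *ₚ z))
      ≈⟨ *-congˡ (coeffₛ-*ₚ k y z) ⟨
    a * coeff (suc k) (y *ₚ z) ∎

  *ₚ-assoc-coeff : ∀ k x y z → coeff k ((x *ₚ y) *ₚ z) ≈ coeff k (x *ₚ (y *ₚ z))
  *ₚ-assoc-coeff zero x y z = begin
    coeff 0 ((x *ₚ y) *ₚ z)                 ≈⟨ coeff₀-*ₚ (x *ₚ y) z ⟩
    coeff 0 (x *ₚ y) * coeff 0 z            ≈⟨ *-congʳ (coeff₀-*ₚ x y) ⟩
    (coeff 0 x * coeff 0 y) * coeff 0 z     ≈⟨ *-assoc _ _ _ ⟩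
    coeff 0 x * (coeff 0 y * coeff 0 z)     ≈⟨ *-congˡ (coeff₀-*ₚ y z) ⟨
    coeff 0 x * coeff 0 (y *ₚ z)            ≈⟨ coeff₀-*ₚ x (y *ₚ z) ⟨
    coeff 0 (x *ₚ (y *ₚ z))                 ∎
  *ₚ-assoc-coeff (suc k) x y z = begin
    coeff (suc k) ((x *ₚ y) *ₚ z)
      ≈⟨ coeffₛ-*ₚ k (x *ₚ y) z ⟩
    coeff 0 (x *ₚ y) * coeff (suc k) z + coeff k (tl (x *ₚ y) *ₚ z)
      ≈⟨ +-cong (*-congʳ (coeff₀-*ₚ x y)) (*ₚ-cong-coeff k (tl-*ₚ x y) ≋-refl) ⟩
    (coeff 0 x * coeff 0 y) * coeff (suc k) z + coeff k ((scale (coeff 0 x) (tl y) +ₚ tl x *ₚ y) *ₚ z)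
      ≈⟨ +-cong (*-assoc _ _ _)
                (trans (*ₚ-distribʳ-coeff k z (scale (coeff 0 x) (tl y)) (tl x *ₚ y))
                       (coeff-+ₚ k (scale (coeff 0 x) (tl y) *ₚ z) ((tl x *ₚ y) *ₚ z))) ⟩
    coeff 0 x * (coeff 0 y * coeff (suc k) z)
      + (coeff k (scale (coeff 0 x) (tl y) *ₚ z) + coeff k ((tl x *ₚ y) *ₚ z))
      ≈⟨ +-congˡ (+-cong (scale-*ₚ-coeff k (coeff 0 x) (tl y) z) (*ₚ-assoc-coeff k (tl x) y z)) ⟩
    coeff 0 x * (coeff 0 y * coeff (suc k) z) + (coeff 0 x * coeff k (tl y *ₚ z) + coeff k (tl x *ₚ (y *ₚ z)))
      ≈⟨ +-assoc _ _ _ ⟨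
    (coeff 0 x * (coeff 0 y * coeff (suc k) z) + coeff 0 x * coeff k (tl y *ₚ z)) + coeff k (tl x *ₚ (y *ₚ z))
      ≈⟨ +-congʳ (distribˡ _ _ _) ⟨
    coeff 0 x * (coeff 0 y * coeff (suc k) z + coeff k (tl y *ₚ z)) + coeff k (tl x *ₚ (y *ₚ z))
      ≈⟨ +-congʳ (*-congˡ (coeffₛ-*ₚ k y z)) ⟨
    coeff 0 x * coeff (suc k) (y *ₚ z) + coeff k (tl x *ₚ (y *ₚ z))
      ≈⟨ coeffₛ-*ₚ k x (y *ₚ z) ⟨
    coeff (suc k) (x *ₚ (y *ₚ z)) ∎

  *ₚ-identityˡ : ∀ x → 1ₚ *ₚ x ≋ x
  *ₚ-identityˡ x = mk≋ λ
    { zero    → trans (coeff₀-*ₚ 1ₚ x) (*-identityˡ _)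
    ; (suc k) → trans (coeffₛ-*ₚ k 1ₚ x) (trans (+-identityʳ _) (*-identityˡ _))
    }

  *ₚ-identityʳ-coeff : ∀ k x → coeff k (x *ₚ 1ₚ) ≈ coeff k x
  *ₚ-identityʳ-coeff zero    x = trans (coeff₀-*ₚ x 1ₚ) (*-identityʳ _)
  *ₚ-identityʳ-coeff (suc k) x =
    trans (coeffₛ-*ₚ k x 1ₚ)
      (trans (+-cong (zeroʳ _) (*ₚ-identityʳ-coeff k (tl x))) (trans (+-identityˡ _) (coeff-tl k x)))

  *ₚ-zeroʳ-coeff : ∀ k x → coeff k (x *ₚ []) ≈ 0#
  *ₚ-zeroʳ-coeff zero    x = trans (coeff₀-*ₚ x []) (zeroʳ _)
  *ₚ-zeroʳ-coeff (suc k) x =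
    trans (coeffₛ-*ₚ k x []) (trans (+-cong (zeroʳ _) (*ₚ-zeroʳ-coeff k (tl x))) (+-identityʳ _))

  polynomialIsSemiring : IsSemiring _≋_ _+ₚ_ _*ₚ_ 0ₚ 1ₚ
  polynomialIsSemiring = record
    { isSemiringWithoutAnnihilatingZero = record
      { +-isCommutativeMonoid = record
        { isMonoid = record
          { isSemigroup = record
            { isMagma = record
              { isEquivalence = record { refl = ≋-refl ; sym = ≋-sym ; trans = ≋-trans }
              ; ∙-cong        = +ₚ-cong
              }
            ; assoc = +ₚ-assoc
            }
          ; identity = (λ _ → ≋-refl) , +ₚ-identityʳ
          }
        ; comm = +ₚ-comm
        }
      ; *-cong     = *ₚ-cong
      ; *-assoc    = λ x y z → mk≋ λ k → *ₚ-assoc-coeff k x y z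
      ; *-identity = *ₚ-identityˡ , λ x → mk≋ λ k → *ₚ-identityʳ-coeff k x
      ; distrib    = (λ x y z → mk≋ λ k → *ₚ-distribˡ-coeff k x y z)
                   , (λ x y z → mk≋ λ k → *ₚ-distribʳ-coeff k x y z)
      }
    ; zero = (λ _ → ≋-refl) , λ x → mk≋ λ k → *ₚ-zeroʳ-coeff k x
    }

  polynomialSemiring : Semiring c ℓ
  polynomialSemiring = record { isSemiring = polynomialIsSemiring }

module Matrices {c ℓ : Level} (R : CommutativeRing c ℓ) where
  open CommutativeRing R renaming (Carrier to K) hiding (zero)
  open PolyMat R
  open Polynomials R
  open import Algebra.Properties.Semiring.Sum polynomialSemiring as ΣA using ()
  open import Algebra.Properties.Semiring.Sum semiring as ΣK using ()
  module A = Semiring polynomialSemiring using (setoid; reflexive; *-assoc; +-commutativeMonoid)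

  infix 4 _≋ₘ_
  _≋ₘ_ : ∀ {n} → Mat n → Mat n → Set ℓ
  M ≋ₘ N = ∀ i j → M i j ≋ N i j

  ≈ₘ⇒≋ₘ : ∀ {n} {M N : Mat n} → M ≈ₘ N → M ≋ₘ N
  ≈ₘ⇒≋ₘ e i j = ≈ₚ⇒≋ (e i j)

  ∑≡sum : ∀ {n} (f : Fin n → Poly) → ∑ f ≡ ΣA.sum f
  ∑≡sum {zero}  f = ≡.refl
  ∑≡sum {suc n} f = ≡.cong (f zero +ₚ_) (∑≡sum (f ∘ suc))

  ∑-cong : ∀ {n} {f g : Fin n → Poly} → (∀ k → f k ≋ g k) → ∑ f ≋ ∑ g
  ∑-cong {zero}  e = ≋-refl
  ∑-cong {suc n} e = +ₚ-cong (e zero) (∑-cong (e ∘ suc))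

  ·-cong : ∀ {n} {M M′ N N′ : Mat n} → M ≋ₘ M′ → N ≋ₘ N′ → M · N ≋ₘ M′ · N′
  ·-cong e f i j = ∑-cong λ k → *ₚ-cong (e i k) (f k j)

  ·-assoc : ∀ {n} (M N Q : Mat n) → (M · N) · Q ≋ₘ M · (N · Q)
  ·-assoc {n} M N Q i j = begin
    ∑ (λ k → ∑ (λ l → M i l *ₚ N l k) *ₚ Q k j)
      ≡⟨ ∑≡sum {n} _ ⟩
    ΣA.sum (λ k → ∑ (λ l → M i l *ₚ N l k) *ₚ Q k j)
      ≈⟨ ΣA.sum-cong-≋ {n} (λ k → *ₚ-cong (A.reflexive (∑≡sum (λ l → M i l *ₚ N l k))) ≋-refl) ⟩
    ΣA.sum (λ k → ΣA.sum (λ l → M i l *ₚ N l k) *ₚ Q k j)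
      ≈⟨ ΣA.sum-cong-≋ {n} (λ k → ΣA.*-distribʳ-sum (Q k j) (λ l → M i l *ₚ N l k)) ⟩
    ΣA.sum (λ k → ΣA.sum (λ l → (M i l *ₚ N l k) *ₚ Q k j))
      ≈⟨ ΣA.sum-cong-≋ {n} (λ k → ΣA.sum-cong-≋ {n} λ l → A.*-assoc (M i l) (N l k) (Q k j)) ⟩
    ΣA.sum (λ k → ΣA.sum (λ l → M i l *ₚ (N l k *ₚ Q k j)))
      ≈⟨ ΣA.∑-comm (λ k l → M i l *ₚ (N l k *ₚ Q k j)) ⟩
    ΣA.sum (λ l → ΣA.sum (λ k → M i l *ₚ (N l k *ₚ Q k j)))
      ≈⟨ ΣA.sum-cong-≋ {n} (λ l → ≋-sym (ΣA.*-distribˡ-sum (M i l) (λ k → N l k *ₚ Q k j))) ⟩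
    ΣA.sum (λ l → M i l *ₚ ΣA.sum (λ k → N l k *ₚ Q k j))
      ≈⟨ ΣA.sum-cong-≋ {n} (λ l → *ₚ-cong {M i l} ≋-refl (A.reflexive (≡.sym (∑≡sum λ k → N l k *ₚ Q k j)))) ⟩
    ΣA.sum (λ l → M i l *ₚ ∑ (λ k → N l k *ₚ Q k j))
      ≡⟨ ≡.sym (∑≡sum {n} _) ⟩
    ∑ (λ l → M i l *ₚ ∑ (λ k → N l k *ₚ Q k j)) ∎
    where open import Relation.Binary.Reasoning.Setoid A.setoid

  I-diagonal : ∀ {n} (i : Fin n) → I i i ≡ 1ₚ
  I-diagonal i with i ≟ i
  ... | yes _  = ≡.refl
  ... | no i≢i = ⊥-elim (i≢i ≡.refl)

  I-off-diagonal : ∀ {n} {i j : Fin n} → i ≢ j → I i j ≡ 0ₚ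
  I-off-diagonal {i = i} {j} i≢j with i ≟ j
  ... | yes i≡j = ⊥-elim (i≢j i≡j)
  ... | no _    = ≡.refl

  I-· : ∀ {n} (M : Mat n) → I · M ≋ₘ M
  I-· {n} M i j = ≋-trans (A.reflexive (∑≡sum {n} _))
    (≋-trans (sum-δ A.+-commutativeMonoid (λ k → I i k *ₚ M k j) i λ k k≢i → ≡⇒0 (I-off-diagonal (k≢i ∘ ≡.sym)))
             (≋-trans (*ₚ-cong (A.reflexive (I-diagonal i)) ≋-refl) (*ₚ-identityˡ (M i j))))
    where
    ≡⇒0 : ∀ {x} → x ≡ 0ₚ → ∀ {y} → x *ₚ y ≋ 0ₚ
    ≡⇒0 ≡.refl = ≋-refl

  coeff-∑ : ∀ {n} k (f : Fin n → Poly) → coeff k (∑ f) ≈ ΣK.sum (λ l → coeff k (f l))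
  coeff-∑ {zero}  k f = refl
  coeff-∑ {suc n} k f = trans (coeff-+ₚ k (f zero) (∑ (f ∘ suc))) (+-congˡ (coeff-∑ k (f ∘ suc)))

  tlₘ : ∀ {n} → Mat n → Mat n
  tlₘ M i j = tl (M i j)

  coeff₀-· : ∀ {n} (M N : Mat n) i j →
             coeff 0 ((M · N) i j) ≈ ΣK.sum (λ l → coeff 0 (M i l) * coeff 0 (N l j))
  coeff₀-· {n} M N i j =
    trans (coeff-∑ {n} 0 _) (ΣK.sum-cong-≋ {n} λ l → coeff₀-*ₚ (M i l) (N l j))

  coeffₛ-· : ∀ {n} k (M N : Mat n) i j →
             coeff (suc k) ((M · N) i j) ≈
             ΣK.sum (λ l → coeff 0 (M i l) * coeff (suc k) (N l j)) + coeff k ((tlₘ M · N) i j)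
  coeffₛ-· {n} k M N i j = begin
    coeff (suc k) ((M · N) i j)
      ≈⟨ coeff-∑ {n} (suc k) _ ⟩
    ΣK.sum (λ l → coeff (suc k) (M i l *ₚ N l j))
      ≈⟨ ΣK.sum-cong-≋ {n} (λ l → coeffₛ-*ₚ k (M i l) (N l j)) ⟩
    ΣK.sum (λ l → coeff 0 (M i l) * coeff (suc k) (N l j) + coeff k (tl (M i l) *ₚ N l j))
      ≈⟨ ΣK.∑-distrib-+ (λ l → coeff 0 (M i l) * coeff (suc k) (N l j)) (λ l → coeff k (tl (M i l) *ₚ N l j)) ⟩
    ΣK.sum (λ l → coeff 0 (M i l) * coeff (suc k) (N l j)) + ΣK.sum (λ l → coeff k (tl (M i l) *ₚ N l j))
      ≈⟨ +-congˡ (coeff-∑ k (λ l → tl (M i l) *ₚ N l j)) ⟨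
    ΣK.sum (λ l → coeff 0 (M i l) * coeff (suc k) (N l j)) + coeff k ((tlₘ M · N) i j) ∎
    where open import Relation.Binary.Reasoning.Setoid setoid

  *ₚ-≈[] : ∀ {J} x {y z} → y ≈[ J ] z → x *ₚ y ≈[ J ] x *ₚ z
  *ₚ-≈[] x {y} {z} y≈z zero    0<J = trans (coeff₀-*ₚ x y) (trans (*-congˡ (y≈z 0 0<J)) (sym (coeff₀-*ₚ x z)))
  *ₚ-≈[] x {y} {z} y≈z (suc k) k<J = trans (coeffₛ-*ₚ k x y)
    (trans (+-cong (*-congˡ (y≈z (suc k) k<J)) (*ₚ-≈[] (tl x) y≈z k (ℕ.<-trans (ℕ.n<1+n k) k<J)))
           (sym (coeffₛ-*ₚ k x z)))

  ·-≈[] : ∀ {n J} (M : Mat n) {N N′ : Mat n} → (∀ i j → N i j ≈[ J ] N′ i j) →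
          ∀ i j → (M · N) i j ≈[ J ] (M · N′) i j
  ·-≈[] {n} M {N} {N′} e i j k k<J =
    trans (coeff-∑ k (λ l → M i l *ₚ N l j))
      (trans (ΣK.sum-cong-≋ {n} λ l → *ₚ-≈[] (M i l) (e l j) k k<J) (sym (coeff-∑ k (λ l → M i l *ₚ N′ l j))))

module LinearCombinations {c ℓ : Level} (R : CommutativeRing c ℓ) where
  open CommutativeRing R renaming (Carrier to K) hiding (zero)
  open import Algebra.Properties.Semiring.Sum semiring as ΣK using ()
  open import Algebra.Properties.Ring ring using (-‿distribˡ-*)
  open import Algebra.Properties.AbelianGroup +-abelianGroup using (⁻¹-∙-comm)
  open import Algebra.Properties.Group +-group using (ε⁻¹≈ε)
  open import Relation.Binary.Reasoning.Setoid setoid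

  lc : ∀ {k n} → Vector K k → (Fin k → Vector K n) → Vector K n
  lc d v j = ΣK.sum (λ l → d l * v l j)

  Independent : ∀ {k n} → (Fin k → Vector K n) → Set (c ⊔ ℓ)
  Independent {k} v = ∀ (d e : Vector K k) → (∀ j → lc d v j ≈ lc e v j) → ∀ l → d l ≈ e l

  InSpan : ∀ {k n} → (Fin k → Vector K n) → Vector K n → Set (c ⊔ ℓ)
  InSpan {k} v w = Σ (Vector K k) λ d → ∀ j → lc d v j ≈ w j

  lc-congˡ : ∀ {k n} {d d′ : Vector K k} (v : Fin k → Vector K n) → (∀ l → d l ≈ d′ l) →
             ∀ j → lc d v j ≈ lc d′ v j
  lc-congˡ {k} v e j = ΣK.sum-cong-≋ {k} λ l → *-congʳ (e l)

  lc-congʳ : ∀ {k n} (d : Vector K k) {v v′ : Fin k → Vector K n} → (∀ l j → v l j ≈ v′ l j) →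
             ∀ j → lc d v j ≈ lc d v′ j
  lc-congʳ {k} d e j = ΣK.sum-cong-≋ {k} λ l → *-congˡ (e l j)

  Independent-cong : ∀ {k n} {v v′ : Fin k → Vector K n} → (∀ l j → v l j ≈ v′ l j) →
                     Independent v → Independent v′
  Independent-cong e ind d d′ h =
    ind d d′ λ j → trans (lc-congʳ d e j) (trans (h j) (sym (lc-congʳ d′ e j)))

  lc-lc : ∀ {k m n} (d : Vector K k) (A : Fin k → Vector K m) (B : Fin m → Vector K n) j →
          lc (lc d A) B j ≈ lc d (λ i → lc (A i) B) j
  lc-lc {k} {m} d A B j = begin
    ΣK.sum (λ l → ΣK.sum (λ i → d i * A i l) * B l j)
      ≈⟨ ΣK.sum-cong-≋ {m} (λ l → ΣK.*-distribʳ-sum (B l j) (λ i → d i * A i l)) ⟩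
    ΣK.sum (λ l → ΣK.sum (λ i → (d i * A i l) * B l j))
      ≈⟨ ΣK.sum-cong-≋ {m} (λ l → ΣK.sum-cong-≋ {k} λ i → *-assoc (d i) (A i l) (B l j)) ⟩
    ΣK.sum (λ l → ΣK.sum (λ i → d i * (A i l * B l j)))
      ≈⟨ ΣK.∑-comm (λ l i → d i * (A i l * B l j)) ⟩
    ΣK.sum (λ i → ΣK.sum (λ l → d i * (A i l * B l j)))
      ≈⟨ ΣK.sum-cong-≋ {k} (λ i → ΣK.*-distribˡ-sum (d i) (λ l → A i l * B l j)) ⟨
    ΣK.sum (λ i → d i * ΣK.sum (λ l → A i l * B l j)) ∎

  -- The hypothesis says d A B = d for every row vector d, that is, A B = 1.
  independent-lc : ∀ {k n} (A B : Fin k → Vector K k) (V : Fin k → Vector K n) →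
                   (∀ d l → lc (lc d A) B l ≈ d l) → Independent V → Independent (λ i → lc (A i) V)
  independent-lc A B V BA ind d e h l = begin
    d l              ≈⟨ BA d l ⟨
    lc (lc d A) B l  ≈⟨ lc-congˡ B (ind (lc d A) (lc e A) dA≈eA) l ⟩
    lc (lc e A) B l  ≈⟨ BA e l ⟩
    e l              ∎
    where
    dA≈eA : ∀ j → lc (lc d A) V j ≈ lc (lc e A) V j
    dA≈eA j = trans (lc-lc d A V j) (trans (h j) (sym (lc-lc e A V j)))

  lc-zeroˡ : ∀ {k n} (v : Fin k → Vector K n) j → lc (λ _ → 0#) v j ≈ 0#
  lc-zeroˡ {k} v j = trans (ΣK.sum-cong-≋ {k} λ l → zeroˡ (v l j)) (ΣK.sum-replicate-zero k)

  lc-scale : ∀ {k n} (a : K) (d : Vector K k) (v : Fin k → Vector K n) j →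
             lc (λ l → a * d l) v j ≈ a * lc d v j
  lc-scale {k} a d v j =
    trans (ΣK.sum-cong-≋ {k} λ l → *-assoc a (d l) (v l j)) (sym (ΣK.*-distribˡ-sum a (λ l → d l * v l j)))

  sum-neg : ∀ {k} (f : Vector K k) → ΣK.sum (λ l → - f l) ≈ - ΣK.sum f
  sum-neg {zero}  f = sym ε⁻¹≈ε
  sum-neg {suc k} f = trans (+-congˡ (sum-neg (f ∘ suc))) (⁻¹-∙-comm (f zero) _)

  lc-sub : ∀ {k n} (d e : Vector K k) (v : Fin k → Vector K n) j →
           lc (λ l → d l - e l) v j ≈ lc d v j - lc e v j
  lc-sub {k} d e v j = begin
    ΣK.sum (λ l → (d l - e l) * v l j)
      ≈⟨ ΣK.sum-cong-≋ {k} (λ l → trans (distribʳ (v l j) (d l) (- e l))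
                                        (+-congˡ (sym (-‿distribˡ-* (e l) (v l j))))) ⟩
    ΣK.sum (λ l → d l * v l j + - (e l * v l j))
      ≈⟨ ΣK.∑-distrib-+ (λ l → d l * v l j) (λ l → - (e l * v l j)) ⟩
    lc d v j + ΣK.sum (λ l → - (e l * v l j))
      ≈⟨ +-congˡ (sum-neg (λ l → e l * v l j)) ⟩
    lc d v j - lc e v j ∎

module Truncation {c ℓ : Level} (R : CommutativeRing c ℓ) (n d : ℕ) where
  open CommutativeRing R renaming (Carrier to K) hiding (zero)
  open PolyMat R
  open Polynomials R
  open Matrices R
  open LinearCombinations R
  open import Algebra.Properties.Semiring.Sum semiring as ΣK using ()
  open import Algebra.Properties.Group +-group using (∙-cancelˡ)
  open import Relation.Binary.Reasoning.Setoid setoid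

  -- A matrix over A/(t^(d+1)), stored as the list of its coefficient matrices.
  Truncated : Set c
  Truncated = Vector (Fin n → Vector K n) (suc d)

  infix 4 _≈ₜ_
  _≈ₜ_ : Truncated → Truncated → Set ℓ
  V ≈ₜ W = ∀ k i j → V k i j ≈ W k i j

  constantTerm : Truncated → Fin n → Vector K n
  constantTerm V = V zero

  lift : Truncated → Mat n
  lift V i j = fromCoeffs (λ k → V k i j)

  truncate : Mat n → Truncated
  truncate M k i j = coeff (Fin.toℕ k) (M i j)

  act : Mat n → Truncated → Truncated
  act M V = truncate (M · lift V)

  lift-truncate : ∀ (M : Mat n) i j → lift (truncate M) i j ≈[ suc d ] M i j
  lift-truncate M i j k k<J = trans (coeff-fromCoeffs-< k k<J (λ k′ → coeff (Fin.toℕ k′) (M i j)))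
                                    (reflexive (≡.cong (λ m → coeff m (M i j)) (Fin.toℕ-fromℕ< k<J)))

  act-congʳ : ∀ (M : Mat n) {V W} → V ≈ₜ W → act M V ≈ₜ act M W
  act-congʳ M V≈W k i j =
    ≋-coeff (·-cong {M = M} (λ _ _ → ≋-refl) (λ i j → fromCoeffs-cong λ k → V≈W k i j) i j) (Fin.toℕ k)

  act-congˡ : ∀ {M N : Mat n} V → M ≋ₘ N → act M V ≈ₜ act N V
  act-congˡ {M} {N} V M≋N k i j =
    ≋-coeff (·-cong {M = M} {N = lift V} M≋N (λ _ _ → ≋-refl) i j) (Fin.toℕ k)

  act-· : ∀ (M N : Mat n) V → act M (act N V) ≈ₜ act (M · N) V
  act-· M N V k i j = begin
    coeff (Fin.toℕ k) ((M · lift (truncate (N · lift V))) i j)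
      ≈⟨ ·-≈[] {J = suc d} M {lift (truncate (N · lift V))} {N · lift V} (lift-truncate (N · lift V))
               i j (Fin.toℕ k) (Fin.toℕ<n k) ⟩
    coeff (Fin.toℕ k) ((M · (N · lift V)) i j)
      ≈⟨ ≋-coeff (·-assoc M N (lift V) i j) (Fin.toℕ k) ⟨
    coeff (Fin.toℕ k) (((M · N) · lift V) i j) ∎

  act-I : ∀ V → act I V ≈ₜ V
  act-I V k i j = trans (≋-coeff (I-· (lift V) i j) (Fin.toℕ k)) (coeff-fromCoeffs k (λ k′ → V k′ i j))

  -- Constant terms cancel by the independence of the rows of Y(0); the tails are then handled by induction.
  ·-cancelʳ-≈[] : (Y : Mat n) → Independent (λ l j → coeff 0 (Y l j)) →
                  ∀ J (M N : Mat n) → (∀ i j → (M · Y) i j ≈[ J ] (N · Y) i j) → ∀ i j → M i j ≈[ J ] N i j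
  ·-cancelʳ-≈[] Y ind zero    M N MY≈NY i j k ()
  ·-cancelʳ-≈[] Y ind (suc J) M N MY≈NY i j = M≈N
    where
    constant : ∀ i l → coeff 0 (M i l) ≈ coeff 0 (N i l)
    constant i = ind (λ l → coeff 0 (M i l)) (λ l → coeff 0 (N i l))
                     (λ j → trans (sym (coeff₀-· M Y i j)) (trans (MY≈NY i j 0 (ℕ.s≤s ℕ.z≤n)) (coeff₀-· N Y i j)))
    tails : ∀ i j → (tlₘ M · Y) i j ≈[ J ] (tlₘ N · Y) i j
    tails i j k k<J = ∙-cancelˡ (ΣK.sum λ l → coeff 0 (M i l) * coeff (suc k) (Y l j)) _ _ (begin
      ΣK.sum (λ l → coeff 0 (M i l) * coeff (suc k) (Y l j)) + coeff k ((tlₘ M · Y) i j)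
        ≈⟨ coeffₛ-· k M Y i j ⟨
      coeff (suc k) ((M · Y) i j)
        ≈⟨ MY≈NY i j (suc k) (ℕ.s≤s k<J) ⟩
      coeff (suc k) ((N · Y) i j)
        ≈⟨ coeffₛ-· k N Y i j ⟩
      ΣK.sum (λ l → coeff 0 (N i l) * coeff (suc k) (Y l j)) + coeff k ((tlₘ N · Y) i j)
        ≈⟨ +-congʳ (ΣK.sum-cong-≋ {n} λ l → *-congʳ (constant i l)) ⟨
      ΣK.sum (λ l → coeff 0 (M i l) * coeff (suc k) (Y l j)) + coeff k ((tlₘ N · Y) i j) ∎)
    M≈N : M i j ≈[ suc J ] N i j
    M≈N zero    _           = constant i j
    M≈N (suc k) (ℕ.s≤s k<J) = trans (sym (coeff-tl k (M i j)))
      (trans (·-cancelʳ-≈[] Y ind J (tlₘ M) (tlₘ N) tails i j k k<J) (coeff-tl k (N i j)))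

  act-injective : ∀ (M N : Mat n) V → Independent (constantTerm V) → act M V ≈ₜ act N V →
                  ∀ i j → M i j ≈[ suc d ] N i j
  act-injective M N V ind MV≈NV = ·-cancelʳ-≈[] (lift V) ind (suc d) M N λ i j k k<J →
    ≡.subst (λ m → coeff m ((M · lift V) i j) ≈ coeff m ((N · lift V) i j))
            (Fin.toℕ-fromℕ< k<J) (MV≈NV (Fin.fromℕ< k<J) i j)

  lc-I₀ : ∀ (e : Vector K n) j → lc e (λ l j → coeff 0 (I l j)) j ≈ e j
  lc-I₀ e j = trans (sum-δ +-commutativeMonoid (λ l → e l * coeff 0 (I l j)) j off)
                    (trans (*-congˡ (reflexive (≡.cong (coeff 0) (I-diagonal j)))) (*-identityʳ (e j)))
    where
    off : ∀ l → l ≢ j → e l * coeff 0 (I l j) ≈ 0#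
    off l l≢j = trans (*-congˡ (reflexive (≡.cong (coeff 0) (I-off-diagonal l≢j)))) (zeroʳ (e l))

  act-independent : ∀ (M N : Mat n) → M · N ≋ₘ I → ∀ V →
                    Independent (constantTerm V) → Independent (constantTerm (act M V))
  act-independent M N MN≋I V ind =
    Independent-cong (λ i j → sym (coeff₀-· M (lift V) i j))
      (independent-lc M₀ N₀ (constantTerm V) inverse ind)
    where
    M₀ N₀ : Fin n → Vector K n
    M₀ i j = coeff 0 (M i j)
    N₀ i j = coeff 0 (N i j)
    inverse : ∀ e l → lc (lc e M₀) N₀ l ≈ e l
    inverse e l = begin
      lc (lc e M₀) N₀ l                  ≈⟨ lc-lc e M₀ N₀ l ⟩
      lc e (λ i → lc (M₀ i) N₀) l        ≈⟨ lc-congʳ e (λ i j → trans (sym (coeff₀-· M N i j)) (≋-coeff (MN≋I i j) 0)) l ⟩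
      lc e (λ i j → coeff 0 (I i j)) l   ≈⟨ lc-I₀ e l ⟩
      e l                                ∎

Enumeration : ∀ {a ℓ} → Setoid a ℓ → ℕ → Set (a ⊔ ℓ)
Enumeration S N = Inverse S (≡.setoid (Fin N))

module _ {a ℓ : Level} {S : Setoid a ℓ} where
  open Setoid S
  open import Data.Vec.Functional.Relation.Binary.Equality.Setoid S using (≋-setoid)

  -- A vector of length m is coded by the mixed-radix number of its entries' codes.
  vectorEnumeration : ∀ {N} → Enumeration S N → ∀ m → Enumeration (≋-setoid m) (N ^ m)
  vectorEnumeration E zero = record
    { to        = λ _ → zero
    ; from      = λ _ ()
    ; to-cong   = λ _ → ≡.refl
    ; from-cong = λ _ ()
    ; inverse   = (λ { {zero} _ → ≡.refl }) , λ _ ()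
    }
  vectorEnumeration {N} E (suc m) = record
    { to        = to
    ; from      = from
    ; to-cong   = to-cong
    ; from-cong = λ { ≡.refl _ → refl }
    ; inverse   = (λ {c} f≋from-c → ≡.trans (to-cong f≋from-c) (to-from c))
                , (λ { {f} ≡.refl → from-to f })
    }
    where
    module E = Inverse E
    module F = Inverse (vectorEnumeration E m)
    to : Vector Carrier (suc m) → Fin (N ^ suc m)
    to f = Fin.combine (E.to (f zero)) (F.to (f ∘ suc))
    to-cong : ∀ {f g} → (∀ i → f i ≈ g i) → to f ≡ to g
    to-cong f≋g = ≡.cong₂ Fin.combine (E.to-cong (f≋g zero)) (F.to-cong (f≋g ∘ suc))
    from : Fin (N ^ suc m) → Vector Carrier (suc m)
    from c = E.from (proj₁ (Fin.remQuot {N} (N ^ m) c)) ∷ᵛ F.from (proj₂ (Fin.remQuot {N} (N ^ m) c))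
    to-from : ∀ c → to (from c) ≡ c
    to-from c = ≡.trans (≡.cong₂ Fin.combine (E.strictlyInverseˡ _) (F.strictlyInverseˡ _))
                        (Fin.combine-remQuot {N} (N ^ m) c)
    from-to : ∀ f i → from (to f) i ≈ f i
    from-to f i = ≡.subst (λ p → (E.from (proj₁ p) ∷ᵛ F.from (proj₂ p)) i ≈ f i)
                          (≡.sym (Fin.remQuot-combine {N} {N ^ m} (E.to (f zero)) (F.to (f ∘ suc))))
                          (from-to′ i)
      where
      from-to′ : ∀ i → (E.from (E.to (f zero)) ∷ᵛ F.from (F.to (f ∘ suc))) i ≈ f i
      from-to′ zero    = E.strictlyInverseʳ (f zero)
      from-to′ (suc i) = F.strictlyInverseʳ (f ∘ suc) i

  vectorEnumeration-from-combine :
    ∀ {N} (E : Enumeration S N) m i j k →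
    Inverse.from (vectorEnumeration E (suc m)) (Fin.combine i j) k ≈
    (Inverse.from E i ∷ᵛ Inverse.from (vectorEnumeration E m) j) k
  vectorEnumeration-from-combine {N} E m i j k =
    reflexive (≡.cong (λ p → (Inverse.from E (proj₁ p) ∷ᵛ Inverse.from (vectorEnumeration E m) (proj₂ p)) k)
                      (Fin.remQuot-combine {N} {N ^ m} i j))

module Counting where
  open import Data.Nat using (_+_; _*_; _≤_)
  open import Data.Nat.Properties
    using (+-suc; +-assoc; *-identityʳ; m<m+n; ≤-refl; ≤-trans; ≤-pred; n≤0⇒n≡0; +-0-commutativeMonoid; +-*-semiring)
  open import Data.Nat.Divisibility using (∣-refl; ∣m∣n⇒∣m+n; _∣0)
  import Data.Bool as Bool
  open import Algebra.Properties.Semiring.Sum +-*-semiring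
    using (sum; sum-cong-≋; ∑-distrib-+; ∑-comm; *-distribʳ-sum; sum-replicate-zero)
  open ≡.≡-Reasoning

  indicator : Bool → ℕ
  indicator true  = 1
  indicator false = 0

  count : ∀ {N} → (Fin N → Bool) → ℕ
  count P = sum (λ i → indicator (P i))

  count-cong : ∀ {N} {P Q : Fin N → Bool} → (∀ i → P i ≡ Q i) → count P ≡ count Q
  count-cong {N} P≡Q = sum-cong-≋ {N} λ i → ≡.cong indicator (P≡Q i)

  sum-const : ∀ N c → sum {N} (λ _ → c) ≡ N * c
  sum-const zero    c = ≡.refl
  sum-const (suc N) c = ≡.cong (c +_) (sum-const N c)

  sum-*ʳ : ∀ {N} (f : Fin N → ℕ) c → sum (λ i → f i * c) ≡ sum f * c
  sum-*ʳ f c = ≡.sym (*-distribʳ-sum c f)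

  sum-↑ : ∀ a {b} (f : Fin (a + b) → ℕ) → sum f ≡ sum (λ i → f (i Fin.↑ˡ b)) + sum (λ j → f (a Fin.↑ʳ j))
  sum-↑ zero    f = ≡.refl
  sum-↑ (suc a) f = ≡.trans (≡.cong (f zero +_) (sum-↑ a (f ∘ suc))) (≡.sym (+-assoc (f zero) _ _))

  sum-combine : ∀ a b (f : Fin (a * b) → ℕ) → sum f ≡ sum (λ i → sum (λ j → f (Fin.combine {a} {b} i j)))
  sum-combine zero    b f = ≡.refl
  sum-combine (suc a) b f = ≡.trans (sum-↑ b f)
    (≡.cong (sum (λ j → f (j Fin.↑ˡ (a * b))) +_) (sum-combine a b (λ c → f (b Fin.↑ʳ c))))

  count-+-count-not : ∀ {N} (P : Fin N → Bool) → count P + count (not ∘ P) ≡ N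
  count-+-count-not {zero}  P = ≡.refl
  count-+-count-not {suc N} P with P zero
  ... | true  = ≡.cong suc (count-+-count-not (P ∘ suc))
  ... | false = ≡.trans (+-suc (count (P ∘ suc)) _) (≡.cong suc (count-+-count-not (P ∘ suc)))

  inImage : ∀ {a b} → (Fin a → Fin b) → Fin b → Bool
  inImage f y = does (Fin.any? λ x → f x ≟ y)

  inImage-image : ∀ {a b} (f : Fin a → Fin b) x → inImage f (f x) ≡ true
  inImage-image f x with Fin.any? (λ x′ → f x′ ≟ f x)
  ... | yes _ = ≡.refl
  ... | no ∄  = ⊥-elim (∄ (x , ≡.refl))

  inImage-preimage : ∀ {a b} (f : Fin a → Fin b) y → inImage f y ≡ true → ∃ λ x → f x ≡ y
  inImage-preimage f y _ with Fin.any? (λ x → f x ≟ y)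
  inImage-preimage f y _  | yes ∃x = ∃x
  inImage-preimage f y () | no _

  count-inImage : ∀ {a b} (f : Fin a → Fin b) → (∀ x x′ → f x ≡ f x′ → x ≡ x′) → count (inImage f) ≡ a
  count-inImage {a} {b} f f-injective = begin
    sum (λ y → indicator (inImage f y))        ≡⟨ sum-cong-≋ {b} image-as-sum ⟩
    sum (λ y → sum (λ x → [ f x ≟ y ]))         ≡⟨ ∑-comm (λ y x → [ f x ≟ y ]) ⟩
    sum (λ x → sum (λ y → [ f x ≟ y ]))         ≡⟨ sum-cong-≋ {a} (λ x → sum-δ +-0-commutativeMonoid _ (f x)
                                                      λ y y≢fx → ≢⇒0 (y≢fx ∘ ≡.sym)) ⟩
    sum (λ x → [ f x ≟ f x ])                   ≡⟨ sum-cong-≋ {a} (λ x → ≡⇒1 {f x} ≡.refl) ⟩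
    sum {a} (λ _ → 1)                           ≡⟨ ≡.trans (sum-const a 1) (*-identityʳ a) ⟩
    a                                           ∎
    where
    [_] : ∀ {x y : Fin b} → Dec (x ≡ y) → ℕ
    [ x≟y ] = indicator (does x≟y)
    ≡⇒1 : ∀ {x y : Fin b} → x ≡ y → [ x ≟ y ] ≡ 1
    ≡⇒1 {x} {y} x≡y with x ≟ y
    ... | yes _  = ≡.refl
    ... | no x≢y = ⊥-elim (x≢y x≡y)
    ≢⇒0 : ∀ {x y : Fin b} → x ≢ y → [ x ≟ y ] ≡ 0
    ≢⇒0 {x} {y} x≢y with x ≟ y
    ... | yes x≡y = ⊥-elim (x≢y x≡y)
    ... | no _    = ≡.refl
    image-as-sum : ∀ y → indicator (inImage f y) ≡ sum (λ x → [ f x ≟ y ])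
    image-as-sum y with Fin.any? (λ x → f x ≟ y)
    ... | yes (x , ≡.refl) = ≡.sym (≡.trans (sum-δ +-0-commutativeMonoid _ x λ x′ x′≢x → ≢⇒0 (x′≢x ∘ f-injective x′ x))
                                            (≡⇒1 {f x} ≡.refl))
    ... | no ∄ = ≡.sym (≡.trans (sum-cong-≋ {a} λ x → ≢⇒0 λ fx≡y → ∄ (x , fx≡y)) (sum-replicate-zero a))

  module FreeAction {g N : ℕ} (act : Fin g → Fin N → Fin N)
                    (_∙_ : Fin g → Fin g → Fin g) (_⁻¹ : Fin g → Fin g) (ε : Fin g)
                    (act-∙ : ∀ a b x → act a (act b x) ≡ act (a ∙ b) x)
                    (act-⁻¹ : ∀ a x → act (a ⁻¹) (act a x) ≡ x) where

    Stable : (Fin N → Bool) → Set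
    Stable Q = ∀ a x → Q x ≡ true → Q (act a x) ≡ true

    FreeOn : (Fin N → Bool) → Set
    FreeOn Q = ∀ a b x → Q x ≡ true → act a x ≡ act b x → a ≡ b

    orbit : Fin N → Fin N → Bool
    orbit x = inImage (λ a → act a x)

    orbit-⊆ : ∀ {Q} → Stable Q → ∀ {x} → Q x ≡ true → ∀ y → orbit x y ≡ true → Q y ≡ true
    orbit-⊆ Q-stable {x} Qx y y∈orbit with inImage-preimage (λ a → act a x) y y∈orbit
    ... | a , ≡.refl = Q-stable a _ Qx

    orbit-act : ∀ x a y → orbit x (act a y) ≡ true → orbit x y ≡ true
    orbit-act x a y ay∈orbit with inImage-preimage (λ b → act b x) (act a y) ay∈orbit
    ... | b , bx≡ay = ≡.subst (λ z → orbit x z ≡ true) (begin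
      act ((a ⁻¹) ∙ b) x     ≡⟨ act-∙ (a ⁻¹) b x ⟨
      act (a ⁻¹) (act b x)   ≡⟨ ≡.cong (act (a ⁻¹)) bx≡ay ⟩
      act (a ⁻¹) (act a y)   ≡⟨ act-⁻¹ a y ⟩
      y                      ∎) (inImage-image (λ c → act c x) ((a ⁻¹) ∙ b))

    count-orbit : ∀ {Q} → FreeOn Q → ∀ {x} → Q x ≡ true → count (orbit x) ≡ g
    count-orbit Q-free {x} Qx = count-inImage (λ a → act a x) λ a b → Q-free a b x Qx

    outside : (Fin N → Bool) → Fin N → Fin N → Bool
    outside Q x y = Q y ∧ not (orbit x y)

    outside-stable : ∀ {Q} → Stable Q → ∀ x → Stable (outside Q x)
    outside-stable {Q} Q-stable x a y Q′y with Q y in Qy | orbit x y in y∉orbit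
    ... | true | false rewrite Q-stable a y Qy with orbit x (act a y) in ay∈orbit
    ...   | false = ≡.refl
    ...   | true  with () ← ≡.trans (≡.sym y∉orbit) (orbit-act x a y ay∈orbit)

    outside-free : ∀ {Q} → FreeOn Q → ∀ x → FreeOn (outside Q x)
    outside-free {Q} Q-free x a b y Q′y with Q y in Qy
    ... | true = Q-free a b y Qy

    count-split : ∀ {Q} → Stable Q → ∀ {x} → Q x ≡ true → count Q ≡ count (outside Q x) + count (orbit x)
    count-split {Q} Q-stable {x} Qx = ≡.trans (sum-cong-≋ {N} pointwise)
      (∑-distrib-+ (λ y → indicator (outside Q x y)) (λ y → indicator (orbit x y)))
      where
      pointwise : ∀ y → indicator (Q y) ≡ indicator (outside Q x y) + indicator (orbit x y)
      pointwise y with orbit x y in y∈orbit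
      ... | true rewrite orbit-⊆ Q-stable Qx y y∈orbit = ≡.refl
      ... | false with Q y
      ...   | true  = ≡.refl
      ...   | false = ≡.refl

    -- Peel off one orbit at a time; each has exactly g points.
    ∣-count : ∀ Q → Stable Q → FreeOn Q → g ∣ count Q
    ∣-count Q = go (count Q) Q ≤-refl
      where
      go : ∀ m Q → count Q ≤ m → Stable Q → FreeOn Q → g ∣ count Q
      go zero    Q Q≤0 _        _      rewrite n≤0⇒n≡0 Q≤0 = g ∣0
      go (suc m) Q Q≤m Q-stable Q-free with Fin.any? (λ x → Q x Bool.≟ true)
      ... | no ∄ = ≡.subst (g ∣_) (≡.sym (≡.trans (sum-cong-≋ {N} empty) (sum-replicate-zero N))) (g ∣0)
        where
        empty : ∀ x → indicator (Q x) ≡ 0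
        empty x with Q x in Qx
        ... | true  = ⊥-elim (∄ (x , Qx))
        ... | false = ≡.refl
      ... | yes (x , Qx) =
        ≡.subst (g ∣_) (≡.sym split) (∣m∣n⇒∣m+n g∣outside (≡.subst (g ∣_) (≡.sym orbit-size) ∣-refl))
        where
        split = count-split Q-stable Qx
        orbit-size = count-orbit Q-free Qx
        g∣outside : g ∣ count (outside Q x)
        g∣outside = go m (outside Q x) (≤-pred (≤-trans smaller Q≤m))
                       (outside-stable Q-stable x) (outside-free Q-free x)
          where
          smaller : suc (count (outside Q x)) ≤ count Q
          smaller = ≡.subst (suc (count (outside Q x)) ≤_)
                            (≡.sym (≡.trans split (≡.cong (count (outside Q x) +_) orbit-size)))
                            (m<m+n (count (outside Q x)) (ℕ.>-nonZero⁻¹ g {{Fin.nonZeroIndex ε}}))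

does-true⇒ : ∀ {a} {A : Set a} (a? : Dec A) → does a? ≡ true → A
does-true⇒ (yes a) _ = a

module FiniteVectorSpace {c ℓ : Level} (R : CommutativeRing c ℓ) (isField : IsField R)
                         {q : ℕ} (card : HasCard R q) (n : ℕ) where
  open CommutativeRing R renaming (Carrier to K) hiding (zero)
  open IsField isField
  open LinearCombinations R
  open Counting
  open import Data.Vec.Functional.Relation.Binary.Equality.Setoid setoid using (≋-setoid)
  open import Algebra.Properties.Group +-group using (∙-cancelˡ; x∙y⁻¹≈ε⇒x≈y)
  open import Algebra.Properties.Ring ring using (-‿distribˡ-*)
  open import Algebra.Solver.CommutativeMonoid +-commutativeMonoid using (solve; _⊕_; _⊜_)

  coefficients : ∀ k → Enumeration (≋-setoid k) (q ^ k)
  coefficients = vectorEnumeration card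

  module Vectors = Inverse (coefficients n)

  families : ∀ k → Enumeration _ ((q ^ n) ^ k)
  families = vectorEnumeration (coefficients n)

  _≈?_ : ∀ x y → Dec (x ≈ y)
  _≈?_ = via-injection (Inverse⇒Injection card) Fin._≟_

  Independent? : ∀ {k} (v : Fin k → Vector K n) → Dec (Independent v)
  Independent? {k} v = map′ fromCodes (λ ind a b → ind (C.from a) (C.from b))
    (Fin.all? λ a → Fin.all? λ b →
       Fin.all? (λ j → lc (C.from a) v j ≈? lc (C.from b) v j) →-dec Fin.all? (λ l → C.from a l ≈? C.from b l))
    where
    module C = Inverse (coefficients k)
    fromCodes : (∀ a b → (∀ j → lc (C.from a) v j ≈ lc (C.from b) v j) → ∀ l → C.from a l ≈ C.from b l) →
                Independent v
    fromCodes ind d e dv≈ev l = begin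
      d l                ≈⟨ C.strictlyInverseʳ d l ⟨
      C.from (C.to d) l  ≈⟨ ind (C.to d) (C.to e) (λ j → begin
                              lc (C.from (C.to d)) v j ≈⟨ lc-congˡ v (C.strictlyInverseʳ d) j ⟩
                              lc d v j                 ≈⟨ dv≈ev j ⟩
                              lc e v j                 ≈⟨ lc-congˡ v (C.strictlyInverseʳ e) j ⟨
                              lc (C.from (C.to e)) v j ∎) l ⟩
      C.from (C.to e) l  ≈⟨ C.strictlyInverseʳ e l ⟩
      e l                ∎
      where open import Relation.Binary.Reasoning.Setoid setoid

  InSpan? : ∀ {k} (v : Fin k → Vector K n) w → Dec (InSpan v w)
  InSpan? {k} v w = map′ (λ (a , h) → C.from a , h)
                         (λ (d , h) → C.to d , λ j → trans (lc-congˡ v (C.strictlyInverseʳ d) j) (h j))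
                         (Fin.any? λ a → Fin.all? λ j → lc (C.from a) v j ≈? w j)
    where module C = Inverse (coefficients k)

  x+y≈z+w⇒x-z≈w-y : ∀ x y z w → x + y ≈ z + w → x - z ≈ w - y
  x+y≈z+w⇒x-z≈w-y x y z w x+y≈z+w = begin
    x - z             ≈⟨ +-identityʳ _ ⟨
    (x - z) + 0#      ≈⟨ +-congˡ (-‿inverseʳ y) ⟨
    (x - z) + (y - y) ≈⟨ solve 4 (λ x z′ y y′ → (x ⊕ z′) ⊕ (y ⊕ y′) ⊜ (x ⊕ y) ⊕ (z′ ⊕ y′)) refl x (- z) y (- y) ⟩
    (x + y) + (- z - y) ≈⟨ +-congʳ x+y≈z+w ⟩
    (z + w) + (- z - y) ≈⟨ solve 4 (λ z w z′ y′ → (z ⊕ w) ⊕ (z′ ⊕ y′) ⊜ (z ⊕ z′) ⊕ (w ⊕ y′)) refl z w (- z) (- y) ⟩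
    (z - z) + (w - y) ≈⟨ +-congʳ (-‿inverseʳ z) ⟩
    0# + (w - y)      ≈⟨ +-identityˡ _ ⟩
    w - y             ∎
    where open import Relation.Binary.Reasoning.Setoid setoid

  module _ {k} (w : Vector K n) (v : Fin k → Vector K n) where

    independent-∷⇒independent : Independent (w ∷ᵛ v) → Independent v
    independent-∷⇒independent ind d e dv≈ev l =
      ind (0# ∷ᵛ d) (0# ∷ᵛ e) (λ j → +-congˡ (dv≈ev j)) (suc l)

    independent-∷⇒∉span : Independent (w ∷ᵛ v) → ¬ InSpan v w
    independent-∷⇒∉span ind (d , dv≈w) = 0≉1 (sym (ind (1# ∷ᵛ λ _ → 0#) (0# ∷ᵛ d) same zero))
      where
      same : ∀ j → lc (1# ∷ᵛ λ _ → 0#) (w ∷ᵛ v) j ≈ lc (0# ∷ᵛ d) (w ∷ᵛ v) j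
      same j = begin
        1# * w j + lc (λ _ → 0#) v j ≈⟨ +-cong (*-identityˡ (w j)) (lc-zeroˡ v j) ⟩
        w j + 0#                     ≈⟨ +-identityʳ (w j) ⟩
        w j                          ≈⟨ dv≈w j ⟨
        lc d v j                     ≈⟨ +-identityˡ _ ⟨
        0# + lc d v j                ≈⟨ +-congʳ (zeroˡ (w j)) ⟨
        0# * w j + lc d v j          ∎
        where open import Relation.Binary.Reasoning.Setoid setoid

    -- If two combinations of w ∷ v agree but differ at w, then (d₀ - e₀)⁻¹ (e - d) expresses w through v.
    independent-∷ : Independent v → ¬ InSpan v w → Independent (w ∷ᵛ v)
    independent-∷ ind w∉span d e dv≈ev with d zero ≈? e zero
    ... | yes d₀≈e₀ = λ { zero → d₀≈e₀ ; (suc l) → tail l }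
      where
      tail : ∀ l → d (suc l) ≈ e (suc l)
      tail = ind (d ∘ suc) (e ∘ suc)
        (λ j → ∙-cancelˡ (d zero * w j) _ _ (trans (dv≈ev j) (+-congʳ (*-congʳ (sym d₀≈e₀)))))
    ... | no d₀≉e₀ = ⊥-elim (w∉span ((λ l → b * (e (suc l) - d (suc l))) , combination))
      where
      a = d zero - e zero
      a≉0 : ¬ (a ≈ 0#)
      a≉0 = d₀≉e₀ ∘ x∙y⁻¹≈ε⇒x≈y (d zero) (e zero)
      b = proj₁ (inverse a a≉0)
      combination : ∀ j → lc (λ l → b * (e (suc l) - d (suc l))) v j ≈ w j
      combination j = begin
        lc (λ l → b * (e (suc l) - d (suc l))) v j
          ≈⟨ lc-scale b (λ l → e (suc l) - d (suc l)) v j ⟩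
        b * lc (λ l → e (suc l) - d (suc l)) v j
          ≈⟨ *-congˡ (lc-sub (e ∘ suc) (d ∘ suc) v j) ⟩
        b * (lc (e ∘ suc) v j - lc (d ∘ suc) v j)
          ≈⟨ *-congˡ (x+y≈z+w⇒x-z≈w-y _ _ _ _ (dv≈ev j)) ⟨
        b * (d zero * w j - e zero * w j)
          ≈⟨ *-congˡ (+-congˡ (-‿distribˡ-* (e zero) (w j))) ⟩
        b * (d zero * w j + - e zero * w j)
          ≈⟨ *-congˡ (distribʳ (w j) (d zero) (- e zero)) ⟨
        b * (a * w j)
          ≈⟨ *-assoc b a (w j) ⟨
        (b * a) * w j
          ≈⟨ *-congʳ (trans (*-comm b a) (proj₂ (inverse a a≉0))) ⟩
        1# * w j
          ≈⟨ *-identityˡ (w j) ⟩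
        w j ∎
        where open import Relation.Binary.Reasoning.Setoid setoid

  isIndependent : ∀ {k} → (Fin k → Vector K n) → Bool
  isIndependent v = does (Independent? v)

  inSpan : ∀ {k} → (Fin k → Vector K n) → Vector K n → Bool
  inSpan v w = does (InSpan? v w)

  isIndependent-cong : ∀ {k} {v v′ : Fin k → Vector K n} → (∀ l j → v l j ≈ v′ l j) →
                       isIndependent v ≡ isIndependent v′
  isIndependent-cong v≈v′ = does-⇔ (mk⇔ (Independent-cong v≈v′) (Independent-cong (λ l j → sym (v≈v′ l j))))
                                    (Independent? _) (Independent? _)

  isIndependent-∷ : ∀ {k} w (v : Fin k → Vector K n) →
                    isIndependent (w ∷ᵛ v) ≡ isIndependent v ∧ not (inSpan v w)
  isIndependent-∷ w v = does-⇔
    (mk⇔ (λ ind → independent-∷⇒independent w v ind , independent-∷⇒∉span w v ind)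
         (λ (ind , w∉span) → independent-∷ w v ind w∉span))
    (Independent? (w ∷ᵛ v)) (Independent? v ×-dec ¬? (InSpan? v w))

  -- The span of k independent vectors is the injective image of K^k.
  count-inSpan : ∀ {k} (v : Fin k → Vector K n) → Independent v → count (λ y → inSpan v (Vectors.from y)) ≡ q ^ k
  count-inSpan {k} v ind = ≡.trans (count-cong (λ y → inSpan≡inImage y))
                                   (count-inImage combine combine-injective)
    where
    module C = Inverse (coefficients k)
    combine : Fin (q ^ k) → Fin (q ^ n)
    combine a = Vectors.to (lc (C.from a) v)
    combine-injective : ∀ a a′ → combine a ≡ combine a′ → a ≡ a′
    combine-injective a a′ ca≡ca′ =
      ≡.trans (≡.sym (C.strictlyInverseˡ a))
        (≡.trans (C.to-cong (ind (C.from a) (C.from a′) (Vectors-injective ca≡ca′))) (C.strictlyInverseˡ a′))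
      where Vectors-injective = Injection.injective (Inverse⇒Injection (coefficients n))
    inSpan≡inImage : ∀ y → inSpan v (Vectors.from y) ≡ inImage combine y
    inSpan≡inImage y = does-⇔ (mk⇔ to from) (InSpan? v (Vectors.from y)) (Fin.any? λ a → combine a ≟ y)
      where
      to : InSpan v (Vectors.from y) → ∃ λ a → combine a ≡ y
      to (d , dv≈y) = C.to d , ≡.trans (Vectors.to-cong λ j → trans (lc-congˡ v (C.strictlyInverseʳ d) j) (dv≈y j))
                                       (Vectors.strictlyInverseˡ y)
      from : (∃ λ a → combine a ≡ y) → InSpan v (Vectors.from y)
      from (a , ca≡y) = C.from a , λ j → sym (Vectors.inverseʳ (≡.sym ca≡y) j)

  independentFamilies : ℕ → ℕ
  independentFamilies k = count (λ c → isIndependent (Inverse.from (families k) c))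

  independentFamilies-zero : independentFamilies 0 ≡ 1
  independentFamilies-zero =
    ≡.cong (λ b → indicator b ℕ.+ 0) (dec-true (Independent? (Inverse.from (families 0) zero)) λ _ _ _ ())

  -- w ∷ v is independent iff v is and w is one of the q^n - q^k vectors outside the span of v.
  independentFamilies-suc : ∀ k → independentFamilies (suc k) ≡ independentFamilies k ℕ.* (q ^ n ∸ q ^ k)
  independentFamilies-suc k = begin
    sum (λ c → indicator (isIndependent (Families₊.from c)))
      ≡⟨ sum-combine (q ^ n) ((q ^ n) ^ k) (λ c → indicator (isIndependent (Families₊.from c))) ⟩
    sum (λ i → sum (λ j → indicator (isIndependent (Families₊.from (extend i j)))))
      ≡⟨ sum-cong-≋ {q ^ n} (λ i → sum-cong-≋ {(q ^ n) ^ k} λ j → ≡.cong indicator (isIndependent-extend i j)) ⟩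
    sum (λ i → sum (λ j → extendsIndependently j i))
      ≡⟨ ∑-comm (λ i j → extendsIndependently j i) ⟩
    sum (λ j → sum (λ i → extendsIndependently j i))
      ≡⟨ sum-cong-≋ {(q ^ n) ^ k} extensions ⟩
    sum (λ j → independent j ℕ.* (q ^ n ∸ q ^ k))
      ≡⟨ sum-*ʳ independent (q ^ n ∸ q ^ k) ⟩
    independentFamilies k ℕ.* (q ^ n ∸ q ^ k) ∎
    where
    open ≡.≡-Reasoning
    open import Algebra.Properties.Semiring.Sum ℕ.+-*-semiring using (sum; sum-cong-≋; ∑-comm; sum-replicate-zero)
    module Families₊ = Inverse (families (suc k))
    module Families = Inverse (families k)
    extend : Fin (q ^ n) → Fin ((q ^ n) ^ k) → Fin ((q ^ n) ^ suc k)
    extend = Fin.combine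
    independent : Fin ((q ^ n) ^ k) → ℕ
    independent j = indicator (isIndependent (Families.from j))
    extendsIndependently : Fin ((q ^ n) ^ k) → Fin (q ^ n) → ℕ
    extendsIndependently j i =
      indicator (isIndependent (Families.from j) ∧ not (inSpan (Families.from j) (Vectors.from i)))
    isIndependent-extend : ∀ i j → isIndependent (Families₊.from (extend i j)) ≡
                                   isIndependent (Families.from j) ∧ not (inSpan (Families.from j) (Vectors.from i))
    isIndependent-extend i j = ≡.trans (isIndependent-cong (vectorEnumeration-from-combine (coefficients n) k i j))
                                       (isIndependent-∷ (Vectors.from i) (Families.from j))
    extensions : ∀ j → sum (extendsIndependently j) ≡ independent j ℕ.* (q ^ n ∸ q ^ k)
    extensions j with isIndependent (Families.from j) in j-independent
    ... | false = sum-replicate-zero (q ^ n)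
    ... | true  = begin
      count (not ∘ inSpanᵥ)                              ≡⟨ ℕ.m+n∸m≡n (q ^ k) (count (not ∘ inSpanᵥ)) ⟨
      (q ^ k ℕ.+ count (not ∘ inSpanᵥ)) ∸ q ^ k          ≡⟨ ≡.cong (λ m → (m ℕ.+ count (not ∘ inSpanᵥ)) ∸ q ^ k) span-size ⟨
      (count inSpanᵥ ℕ.+ count (not ∘ inSpanᵥ)) ∸ q ^ k  ≡⟨ ≡.cong (_∸ q ^ k) (count-+-count-not inSpanᵥ) ⟩
      q ^ n ∸ q ^ k                                      ≡⟨ ℕ.+-identityʳ _ ⟨
      1 ℕ.* (q ^ n ∸ q ^ k)                              ∎
      where
      inSpanᵥ : Fin (q ^ n) → Bool
      inSpanᵥ i = inSpan (Families.from j) (Vectors.from i)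
      span-size : count inSpanᵥ ≡ q ^ k
      span-size = count-inSpan (Families.from j) (does-true⇒ (Independent? _) j-independent)

module Arithmetic where
  open import Data.Nat using (_+_; _*_)
  open import Data.Nat.Properties using (+-suc; +-identityʳ; *-identityʳ; *-assoc; ^-distribˡ-+-*; *-distribˡ-∸)
  open import Data.Nat.Divisibility using (∣-trans)
  import Data.Nat.Coprimality as Coprimality
  open import Data.Nat.Solver using (module +-*-Solver)
  open +-*-Solver
  open ≡.≡-Reasoning

  coprime-* : ∀ {m a b} → Coprime m a → Coprime m b → Coprime m (a * b)
  coprime-* m⊥a m⊥b (i∣m , i∣ab) = m⊥b (i∣m , coprime-divisor (λ (j∣i , j∣a) → m⊥a (∣-trans j∣i i∣m , j∣a)) i∣ab)

  coprime-^ : ∀ {m a} → Coprime m a → ∀ e → Coprime m (a ^ e)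
  coprime-^ {m} m⊥a zero    = Coprimality.sym (Coprimality.1-coprimeTo m)
  coprime-^     m⊥a (suc e) = coprime-* m⊥a (coprime-^ m⊥a e)

  -- ∏_{k<n} (q^n - q^k) = q^(0 + 1 + ⋯ + (n-1)) · ∏_{s=1}^{n} (q^s - 1): pull q^k out of the k-th factor.
  module _ (q n : ℕ) (C : ℕ → ℕ) (C-zero : C 0 ≡ 1) (C-suc : ∀ k → C (suc k) ≡ C k * (q ^ n ∸ q ^ k)) where

    q^e*prodGL : ∀ k r → k + r ≡ n → ∃ λ e → C k * prodGL q r ≡ q ^ e * prodGL q n
    q^e*prodGL zero    r ≡.refl = 0 , ≡.cong (_* prodGL q r) C-zero
    q^e*prodGL (suc k) r k+r≡n with q^e*prodGL k (suc r) (≡.trans (+-suc k r) k+r≡n)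
    ... | e , IH = k + e , (begin
      C (suc k) * prodGL q r                ≡⟨ ≡.cong (_* prodGL q r) (C-suc k) ⟩
      C k * (q ^ n ∸ q ^ k) * prodGL q r    ≡⟨ ≡.cong (λ z → C k * z * prodGL q r) factor ⟩
      C k * (q ^ k * b) * prodGL q r        ≡⟨ solve 4 (λ c a b p → c :* (a :* b) :* p := a :* (c :* (p :* b))) ≡.refl
                                                        (C k) (q ^ k) b (prodGL q r) ⟩
      q ^ k * (C k * prodGL q (suc r))      ≡⟨ ≡.cong (q ^ k *_) IH ⟩
      q ^ k * (q ^ e * prodGL q n)          ≡⟨ *-assoc (q ^ k) (q ^ e) _ ⟨
      q ^ k * q ^ e * prodGL q n            ≡⟨ ≡.cong (_* prodGL q n) (^-distribˡ-+-* q k e) ⟨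
      q ^ (k + e) * prodGL q n              ∎)
      where
      b = q ^ suc r ∸ 1
      factor : q ^ n ∸ q ^ k ≡ q ^ k * b
      factor = begin
        q ^ n ∸ q ^ k                  ≡⟨ ≡.cong (λ z → q ^ z ∸ q ^ k) (≡.trans (+-suc k r) k+r≡n) ⟨
        q ^ (k + suc r) ∸ q ^ k        ≡⟨ ≡.cong₂ _∸_ (^-distribˡ-+-* q k (suc r)) (≡.sym (*-identityʳ (q ^ k))) ⟩
        q ^ k * q ^ suc r ∸ q ^ k * 1  ≡⟨ *-distribˡ-∸ (q ^ k) (q ^ suc r) 1 ⟨
        q ^ k * b                      ∎

    recurrence⇒q^e*prodGL : ∃ λ e → C n ≡ q ^ e * prodGL q n
    recurrence⇒q^e*prodGL with q^e*prodGL n 0 (+-identityʳ n)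
    ... | e , Cn*1≡ = e , ≡.trans (≡.sym (*-identityʳ (C n))) Cn*1≡

supremum : ∀ {m} → Vector ℕ m → ℕ
supremum {zero}  f = 0
supremum {suc m} f = f zero ℕ.⊔ supremum (f ∘ suc)

≤-supremum : ∀ {m} (f : Vector ℕ m) i → f i ℕ.≤ supremum f
≤-supremum f zero    = ℕ.m≤m⊔n (f zero) _
≤-supremum f (suc i) = ℕ.≤-trans (≤-supremum (f ∘ suc) i) (ℕ.m≤n⊔m (f zero) _)

module _ {a ℓ : Level} (S : Setoid a ℓ) where
  open Setoid S

  lookup-injective : ∀ {xs} → AllPairs (λ x y → ¬ x ≈ y) xs → ∀ i j → lookup xs i ≈ lookup xs j → i ≡ j
  lookup-injective (x≉ ∷ _)  zero    zero    _  = ≡.refl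
  lookup-injective (x≉ ∷ _)  zero    (suc j) x≈ = ⊥-elim (All.lookup x≉ (∈ₚ-lookup j) x≈)
  lookup-injective (x≉ ∷ _)  (suc i) zero    ≈x = ⊥-elim (All.lookup x≉ (∈ₚ-lookup i) (sym ≈x))
  lookup-injective (_ ∷ xs≉) (suc i) (suc j) e  = ≡.cong suc (lookup-injective xs≉ i j e)

module FiniteSubgroupOrder {c ℓ : Level} (R : CommutativeRing c ℓ) (isField : IsField R)
                           {q : ℕ} (card : HasCard R q) {n : ℕ} (G : PolyMat.FiniteSubgroupGL R n) where
  open CommutativeRing R renaming (Carrier to K) hiding (zero)
  open PolyMat R
  open FiniteSubgroupGL G
  open Polynomials R
  open Matrices R
  open LinearCombinations R
  open FiniteVectorSpace R isField card n
  open Counting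

  matrixSetoid : Setoid c ℓ
  matrixSetoid = record
    { Carrier       = Mat n
    ; _≈_           = _≈ₘ_
    ; isEquivalence = record
      { refl  = λ i j → ≋⇒≈ₚ ≋-refl
      ; sym   = λ M≈N i j → ≋⇒≈ₚ (≋-sym (≈ₚ⇒≋ (M≈N i j)))
      ; trans = λ M≈N N≈P i j → ≋⇒≈ₚ (≋-trans (≈ₚ⇒≋ (M≈N i j)) (≈ₚ⇒≋ (N≈P i j)))
      }
    }

  g : ℕ
  g = order G

  element : Fin g → Mat n
  element = lookup elems

  element∈G : ∀ a → element a ∈ₘ elems
  element∈G = ∈-lookup matrixSetoid elems

  _∙_ : Fin g → Fin g → Fin g
  a ∙ b = Any.index (mulClosed (element∈G a) (element∈G b))

  ∙-element : ∀ a b → element a · element b ≋ₘ element (a ∙ b)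
  ∙-element a b = ≈ₘ⇒≋ₘ (lookup-index (mulClosed (element∈G a) (element∈G b)))

  rightInverse : Fin g → Mat n
  rightInverse a = proj₁ (invClosed (element∈G a))

  rightInverse∈G : ∀ a → rightInverse a ∈ₘ elems
  rightInverse∈G a = proj₁ (proj₂ (invClosed (element∈G a)))

  ·-rightInverse : ∀ a → element a · rightInverse a ≋ₘ I
  ·-rightInverse a = ≈ₘ⇒≋ₘ (proj₁ (proj₂ (proj₂ (invClosed (element∈G a)))))

  rightInverse-· : ∀ a → rightInverse a · element a ≋ₘ I
  rightInverse-· a = ≈ₘ⇒≋ₘ (proj₂ (proj₂ (proj₂ (invClosed (element∈G a)))))

  _⁻¹ : Fin g → Fin g
  a ⁻¹ = Any.index (rightInverse∈G a)

  ⁻¹-element : ∀ a → element (a ⁻¹) · element a ≋ₘ I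
  ⁻¹-element a i j = ≋-trans (·-cong {N = element a} element≋ (λ _ _ → ≋-refl) i j) (rightInverse-· a i j)
    where
    element≋ : element (a ⁻¹) ≋ₘ rightInverse a
    element≋ = ≈ₘ⇒≋ₘ (Setoid.sym matrixSetoid (lookup-index (rightInverse∈G a)))

  ε : Fin g
  ε = Any.index hasId

  entryLength : Fin g → Fin n → Fin n → ℕ
  entryLength a i j = length (element a i j)

  d : ℕ
  d = supremum λ a → supremum λ i → supremum (entryLength a i)

  length-≤ : ∀ a i j → entryLength a i j ℕ.≤ suc d
  length-≤ a i j = ℕ.m≤n⇒m≤1+n
    (ℕ.≤-trans (≤-supremum (entryLength a i) j)
      (ℕ.≤-trans (≤-supremum (λ i → supremum (entryLength a i)) i)
                 (≤-supremum (λ a → supremum λ i → supremum (entryLength a i)) a)))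

  open Truncation R n d

  qⁿⁿ : ℕ
  qⁿⁿ = (q ^ n) ^ n

  codes : Enumeration _ (qⁿⁿ ^ suc d)
  codes = vectorEnumeration (families n) (suc d)

  module Code = Inverse codes

  act′ : Fin g → Fin (qⁿⁿ ^ suc d) → Fin (qⁿⁿ ^ suc d)
  act′ a x = Code.to (act (element a) (Code.from x))

  act′-∙ : ∀ a b x → act′ a (act′ b x) ≡ act′ (a ∙ b) x
  act′-∙ a b x = Code.to-cong
    (Code.Eq₁.trans (act-congʳ (element a) (Code.strictlyInverseʳ (act (element b) (Code.from x))))
      (Code.Eq₁.trans (act-· (element a) (element b) (Code.from x)) (act-congˡ (Code.from x) (∙-element a b))))

  act′-⁻¹ : ∀ a x → act′ (a ⁻¹) (act′ a x) ≡ x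
  act′-⁻¹ a x = ≡.trans (Code.to-cong
    (Code.Eq₁.trans (act-congʳ (element (a ⁻¹)) (Code.strictlyInverseʳ (act (element a) (Code.from x))))
      (Code.Eq₁.trans (act-· (element (a ⁻¹)) (element a) (Code.from x))
        (Code.Eq₁.trans (act-congˡ (Code.from x) (⁻¹-element a)) (act-I (Code.from x))))))
    (Code.strictlyInverseˡ x)

  invertibleConstantTerm : Fin (qⁿⁿ ^ suc d) → Bool
  invertibleConstantTerm x = isIndependent (constantTerm (Code.from x))

  open FreeAction act′ _∙_ _⁻¹ ε act′-∙ act′-⁻¹

  invertibleConstantTerm-stable : Stable invertibleConstantTerm
  invertibleConstantTerm-stable a x invertible = dec-true (Independent? _)
    (Independent-cong (λ i j → sym (Code.strictlyInverseʳ (act (element a) (Code.from x)) zero i j))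
      (act-independent (element a) (rightInverse a) (·-rightInverse a) (Code.from x)
        (does-true⇒ (Independent? _) invertible)))

  -- Elements of G have degree at most d, so they are determined by their image modulo t^(d+1).
  invertibleConstantTerm-free : FreeOn invertibleConstantTerm
  invertibleConstantTerm-free a b x invertible ax≡bx = lookup-injective matrixSetoid distinct a b λ i j →
    ≋⇒≈ₚ (≈[]⇒≋ (length-≤ a i j) (length-≤ b i j)
      (act-injective (element a) (element b) (Code.from x) (does-true⇒ (Independent? _) invertible)
        (Injection.injective (Inverse⇒Injection codes) ax≡bx) i j))

  count-invertibleConstantTerm : count invertibleConstantTerm ≡ independentFamilies n ℕ.* qⁿⁿ ^ d
  count-invertibleConstantTerm = begin
    count invertibleConstantTerm
      ≡⟨ sum-combine qⁿⁿ (qⁿⁿ ^ d) (indicator ∘ invertibleConstantTerm) ⟩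
    sum (λ i → sum (λ j → indicator (isIndependent (Code.from (extend i j) zero))))
      ≡⟨ sum-cong-≋ {qⁿⁿ} (λ i → sum-cong-≋ {qⁿⁿ ^ d} λ j → ≡.cong indicator (constantTerm-extend i j)) ⟩
    sum (λ i → sum {qⁿⁿ ^ d} (λ _ → invertible i))
      ≡⟨ sum-cong-≋ {qⁿⁿ} (λ i → ≡.trans (sum-const (qⁿⁿ ^ d) (invertible i)) (ℕ.*-comm (qⁿⁿ ^ d) (invertible i))) ⟩
    sum (λ i → invertible i ℕ.* qⁿⁿ ^ d)
      ≡⟨ sum-*ʳ invertible (qⁿⁿ ^ d) ⟩
    independentFamilies n ℕ.* qⁿⁿ ^ d ∎
    where
    open ≡.≡-Reasoning
    open import Algebra.Properties.Semiring.Sum ℕ.+-*-semiring using (sum; sum-cong-≋)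
    module Families = Inverse (families n)
    extend : Fin qⁿⁿ → Fin (qⁿⁿ ^ d) → Fin (qⁿⁿ ^ suc d)
    extend = Fin.combine
    invertible : Fin qⁿⁿ → ℕ
    invertible i = indicator (isIndependent (Families.from i))
    constantTerm-extend : ∀ i j → isIndependent (Code.from (extend i j) zero) ≡ isIndependent (Families.from i)
    constantTerm-extend i j = isIndependent-cong (vectorEnumeration-from-combine (families n) d i j zero)

  order-∣-count : g ∣ count invertibleConstantTerm
  order-∣-count = ∣-count invertibleConstantTerm invertibleConstantTerm-stable invertibleConstantTerm-free

  order-∣ : ∃ λ e → g ∣ q ^ e ℕ.* prodGL q n
  order-∣ with Arithmetic.recurrence⇒q^e*prodGL q n independentFamilies independentFamilies-zero independentFamilies-suc
  ... | e , GLn≡ = e ℕ.+ f , ≡.subst (g ∣_) count≡ order-∣-count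
    where
    open ≡.≡-Reasoning
    open Data.Nat.Solver.+-*-Solver
    f = n ℕ.* n ℕ.* d
    count≡ : count invertibleConstantTerm ≡ q ^ (e ℕ.+ f) ℕ.* prodGL q n
    count≡ = begin
      count invertibleConstantTerm           ≡⟨ count-invertibleConstantTerm ⟩
      independentFamilies n ℕ.* qⁿⁿ ^ d      ≡⟨ ≡.cong₂ ℕ._*_ GLn≡ (≡.trans (≡.cong (_^ d) (ℕ.^-*-assoc q n n))
                                                                       (ℕ.^-*-assoc q (n ℕ.* n) d)) ⟩
      q ^ e ℕ.* prodGL q n ℕ.* q ^ f         ≡⟨ solve 3 (λ a p b → a :* p :* b := a :* b :* p) ≡.refl
                                                        (q ^ e) (prodGL q n) (q ^ f) ⟩
      q ^ e ℕ.* q ^ f ℕ.* prodGL q n         ≡⟨ ≡.cong (ℕ._* prodGL q n) (ℕ.^-distribˡ-+-* q e f) ⟨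
      q ^ (e ℕ.+ f) ℕ.* prodGL q n           ∎

lemma2p12 : {c ℓ : Level} (p k q : ℕ) → Prime p → k ≥ 1 → q ≡ p ^ k →
    (F : CommutativeRing c ℓ) → IsField F → HasCard F q →
    (n : ℕ) → n ≥ 1 → (G : PolyMat.FiniteSubgroupGL F n) →
    (m : ℕ) → IsLargestDivisorPrimeTo p (PolyMat.order F G) m →
    m ∣ prodGL q n
lemma2p12 p k q _ _ q≡p^k F isField card n _ G m (m∣|G| , m⊥p , _) =
  coprime-divisor m⊥q^e (∣-trans m∣|G| |G|∣q^e*prodGL)
  where
  open FiniteSubgroupOrder F isField card G using (order-∣)
  e = proj₁ order-∣
  |G|∣q^e*prodGL = proj₂ order-∣
  m⊥q^e : Coprime m (q ^ e)
  m⊥q^e = Arithmetic.coprime-^ (≡.subst (Coprime m) (≡.sym q≡p^k) (Arithmetic.coprime-^ m⊥p k)) e
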